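{- Let $r \ge 2$ and $m \ge 1$ be integers, let $n$ be sufficiently large, let $G$ be an $n$-vertex graph with minimum degree $\delta(G) = \frac{n}{2} + 6r^{2}m$, and let $\chi : E(G) \to [r]$ be an edge-coloring such that every Hamilton cycle $H \subseteq G$ satisfies $d_{\chi}(H) < m$. Then there exists an induced subgraph $G' \subseteq G$ with $|V(G) \setminus V(G')| \le 10rm$ such that $G'$ contains no bad bowtie.
   Context: For a Hamilton cycle $H$ in $G$, its color-bias is $d_{\chi}(H) = \max_{i \in [r]} \left|\, |\chi^{ -1}(i) \cap E(H)| - \frac{n}{r} \right|$, where $\chi^{ -1}(i)=\{e\in E(G):\chi(e)=i\}$. A bowtie $v_1v_2v_3v_4v_5$ in a graph is a set of five distinct vertices $v_1,\dots,v_5$ such that $v_1v_2, v_1v_3, v_1v_4, v_1v_5, v_2v_3, v_4v_5$ are all edges (two triangles sharing the vertex $v_1$). For a color $k$ and a bowtie $B = v_1v_2v_3v_4v_5$, define $f(B,k) = \mathbf{1}_k(v_1v_2) + \mathbf{1}_k(v_1v_3) + \mathbf{1}_k(v_4v_5) - \mathbf{1}_k(v_1v_4) - \mathbf{1}_k(v_1v_5) - \mathbf{1}_k(v_2v_3)$, where $\mathbf{1}_k(e) = 1$ if $\chi(e) = k$ and $0$ otherwise. The bowtie $B$ is $k$-bad if $f(B,k) \ne 0$, and bad if it is $k$-bad for some $k \in [r]$. -}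

module Defs where

open import Data.Nat using (ℕ; zero; suc; _+_; _*_; _≤_; _<_; _⊓_; ∣_-_∣)
open import Data.Nat.Properties using (_<?_)
open import Data.Bool using (Bool; true; false; if_then_else_)
open import Data.Fin using (Fin; toℕ; fromℕ<) renaming (zero to fzero)
open import Data.Fin.Permutation using (Permutation′; _⟨$⟩ʳ_)
open import Data.Fin.Subset using (Subset; _∈_; _∉_)
open import Data.List using (List; foldr; map; allFin)
open import Data.Nat.ListAction using (sum)
open import Data.Integer using (ℤ; +_; _-_; +0)
open import Data.Product using (Σ; ∃; _×_)
open import Relation.Binary.PropositionalEquality using (_≡_; _≢_)
open import Relation.Nullary using (¬_; yes; no)
open import Relation.Nullary.Decidable using (does)
open import Data.Fin using (_≟_)

record Graph (n : ℕ) : Set where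
  field
    adj  : Fin n → Fin n → Bool
    sym  : ∀ u v → adj u v ≡ adj v u
    irr  : ∀ v → adj v v ≡ false
open Graph public

count : ∀ {n} → (Fin n → Bool) → ℕ
count {n} p = sum (map (λ i → if p i then 1 else 0) (allFin n))

degree : ∀ {n} → Graph n → Fin n → ℕ
degree G v = count (adj G v)

-- minimum degree δ(G) (for n ≥ 1 this is the minimum of the degrees,
-- since every degree is < n)
minDegree : ∀ {n} → Graph n → ℕ
minDegree {n} G = foldr _⊓_ n (map (degree G) (allFin n))

-- An edge colouring χ : E(G) → [r], represented as a symmetric function on
-- pairs of vertices (its values on non-edges are irrelevant).
record EdgeColoring {n : ℕ} (G : Graph n) (r : ℕ) : Set where
  field
    col : Fin n → Fin n → Fin r
    col-sym : ∀ u v → col u v ≡ col v u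
open EdgeColoring public

next : ∀ {n} → Fin n → Fin n
next {suc k} i with toℕ i <? k
... | yes p = fromℕ< (Data.Nat.s≤s p)
... | no _  = fzero

record HamiltonCycle {n : ℕ} (G : Graph n) : Set where
  field
    three≤n : 3 ≤ n
    σ       : Permutation′ n
    edges   : ∀ i → adj G (σ ⟨$⟩ʳ i) (σ ⟨$⟩ʳ next i) ≡ true
open HamiltonCycle public

-- |χ⁻¹(k) ∩ E(H)|: the edges of H are σ(i)σ(i+1), i ∈ Fin n (distinct).
colorCount : ∀ {n r} {G : Graph n} → EdgeColoring G r → HamiltonCycle G → Fin r → ℕ
colorCount χ H k =
  count (λ i → does (col χ (σ H ⟨$⟩ʳ i) (σ H ⟨$⟩ʳ next i) ≟ k))

-- d_χ(H) < m, i.e. for all k : | |χ⁻¹(k) ∩ E(H)| - n/r | < m,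
-- written after multiplying through by r > 0:  | r·c_k - n | < r·m.
ColorBiasLt : ∀ {n r} {G : Graph n} → EdgeColoring G r → HamiltonCycle G → ℕ → Set
ColorBiasLt {n} {r} χ H m = ∀ k → ∣ r * colorCount χ H k - n ∣ < r * m

𝟙 : ∀ {n r} {G : Graph n} → EdgeColoring G r → Fin r → Fin n → Fin n → ℤ
𝟙 χ k u v = if does (col χ u v ≟ k) then + 1 else + 0

IsBowtie : ∀ {n} → Graph n → Fin n → Fin n → Fin n → Fin n → Fin n → Set
IsBowtie G v1 v2 v3 v4 v5 =
  (v1 ≢ v2) × (v1 ≢ v3) × (v1 ≢ v4) × (v1 ≢ v5) × (v2 ≢ v3) ×
  (v2 ≢ v4) × (v2 ≢ v5) × (v3 ≢ v4) × (v3 ≢ v5) × (v4 ≢ v5) ×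
  (adj G v1 v2 ≡ true) × (adj G v1 v3 ≡ true) × (adj G v1 v4 ≡ true) ×
  (adj G v1 v5 ≡ true) × (adj G v2 v3 ≡ true) × (adj G v4 v5 ≡ true)

f : ∀ {n r} {G : Graph n} → EdgeColoring G r → Fin n → Fin n → Fin n → Fin n → Fin n → Fin r → ℤ
f χ v1 v2 v3 v4 v5 k =
  ((((((𝟙 χ k v1 v2 Data.Integer.+ 𝟙 χ k v1 v3) Data.Integer.+ 𝟙 χ k v4 v5)
      - 𝟙 χ k v1 v4) - 𝟙 χ k v1 v5) - 𝟙 χ k v2 v3))

Bad : ∀ {n r} {G : Graph n} → EdgeColoring G r → Fin n → Fin n → Fin n → Fin n → Fin n → Set
Bad χ v1 v2 v3 v4 v5 = ∃ λ k → f χ v1 v2 v3 v4 v5 k ≢ +0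

-- The induced subgraph G' = G − R (vertices not in R) contains no bad bowtie.
-- (Since G' is induced, a bowtie of G' is exactly a bowtie of G whose
-- vertices all lie outside R, with the same colours.)
NoBadBowtieOutside : ∀ {n r} {G : Graph n} → EdgeColoring G r → Subset n → Set
NoBadBowtieOutside {G = G} χ R = ∀ v1 v2 v3 v4 v5 →
  v1 ∉ R → v2 ∉ R → v3 ∉ R → v4 ∉ R → v5 ∉ R →
  IsBowtie G v1 v2 v3 v4 v5 → ¬ Bad χ v1 v2 v3 v4 v5

{-# OPTIONS --safe #-}
-- Fix a colour k. Switching a bowtie v₁v₂v₃v₄v₅ in a Hamilton cycle that uses the edges v₁v₂,
-- v₁v₃ and v₄v₅ replaces them by v₁v₄, v₁v₅ and v₂v₃; for a k-bad bowtie, read in the right one of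
-- its two orientations, this strictly increases the number of k-edges. Collect vertex-disjoint
-- such bowties greedily. If 2m of them exist, lay them out as paths in a cyclic ordering of V(G)
-- and close it into a Hamilton cycle H by Pósa rotations; the degree-sum bound n + 12r²m leaves
-- room never to break an edge among the ≤ 10m collected vertices. Switching every collected
-- bowtie of H gives a Hamilton cycle with at least 2m more k-edges, so H or the new cycle has
-- colour bias at least m. Hence every colour stops with fewer than 2m bowties, and deleting the
-- at most 10rm collected vertices leaves no bad bowtie.
--
-- A cyclic ordering is a list; the quantities attached to it (non-edges, whether it traverses
-- uv, number of k-edges) are all cycleSum h for a symmetric weight h, so rotations and switches
-- are proved once, as identities in h.
module Submission where

open import Defs hiding (sym)

open import Data.Bool using (Bool; true; false; if_then_else_; _∧_; _∨_; not)
open import Data.Bool.ListAction using (any)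
open import Data.Bool.Properties using (∧-comm; ∨-comm; ∨-zeroʳ) renaming (_≟_ to _≟ᵇ_)
open import Data.Empty using (⊥-elim)
open import Data.Fin using (Fin; _≟_; toℕ; fromℕ; inject₁; cast) renaming (zero to fzero; suc to fsuc)
open import Data.Fin.Permutation using (_⟨$⟩ʳ_)
open import Data.Fin.Properties
  using (toℕ-injective; toℕ<n; toℕ-fromℕ; toℕ-fromℕ<; toℕ-inject₁; cast-involutive; cast-is-id; any?)
open import Data.Fin.Subset using (Subset; ∣_∣; _∉_)
import Data.Integer as ℤ
open ℤ using (ℤ)
open import Data.Integer.Properties using (pos-+; +-inverseʳ)
import Data.Integer.Tactic.RingSolver as ℤ-Solver
open import Data.List
  using (List; []; _∷_; _++_; [_]; map; reverse; length; allFin; tabulate; lookup; foldr; filterᵇ)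
open import Data.List.Membership.Propositional using (_∈_)
open import Data.List.Membership.Propositional.Properties using (∈-allFin; ∈-map⁺)
open import Data.List.Properties
  using (++-assoc; ++-identityʳ; unfold-reverse; map-++; map-tabulate; length-tabulate; tabulate-cong; tabulate-lookup)
open import Data.List.Relation.Binary.Permutation.Propositional
  using (_↭_; ↭-refl; prep; swap; ↭-trans; module PermutationReasoning)
open import Data.List.Relation.Binary.Permutation.Propositional.Properties
  using (map⁺; ++-comm; ↭-reverse; shift; ++⁺ˡ; ++⁺ʳ)
open import Data.List.Relation.Unary.All using (All; []; _∷_)
open import Data.List.Relation.Unary.AllPairs using ([]; _∷_)
open import Data.List.Relation.Unary.Any using (here; there)
open import Data.List.Relation.Unary.Unique.Propositional using (Unique)
open import Data.Nat using (ℕ; zero; suc; _+_; _*_; _≤_; _<_; z≤n; s≤s; _⊓_; ∣_-_∣)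
open import Data.Nat.ListAction using (sum)
open import Data.Nat.ListAction.Properties using (sum-++; sum-↭)
open import Data.Nat.Properties hiding (_≟_)
open import Data.Nat.Tactic.RingSolver using (solve-∀)
open import Data.Product using (Σ; ∃; _×_; _,_; proj₁; proj₂)
open import Data.Sum using (_⊎_; inj₁; inj₂)
open import Data.Unit using (⊤; tt)
import Data.Vec as Vec
open import Data.Vec.Properties using (lookup∘tabulate; lookup⇒[]=)
open import Function using (_∘_; id)
open import Function.Bundles using (mk↔ₛ′)
open import Relation.Binary.Definitions using (tri<; tri≈; tri>)
open import Relation.Binary.PropositionalEquality hiding ([_])
open import Relation.Nullary using (¬_; Dec; yes; no; does; ¬?)
open import Relation.Nullary.Decidable using (_×-dec_)

⟦_⟧ : Bool → ℕ
⟦ b ⟧ = if b then 1 else 0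

false≢true : false ≢ true
false≢true ()

1≤+⇒ : ∀ m n → 1 ≤ m + n → (1 ≤ m) ⊎ (1 ≤ n)
1≤+⇒ (suc m) n _   = inj₁ (s≤s z≤n)
1≤+⇒ zero    n 1≤n = inj₂ 1≤n

⟦⟧≤1 : ∀ b → ⟦ b ⟧ ≤ 1
⟦⟧≤1 true  = s≤s z≤n
⟦⟧≤1 false = z≤n

⟦⟧-∨ : ∀ b c → (b ≡ true → c ≡ false) → ⟦ b ∨ c ⟧ ≡ ⟦ b ⟧ + ⟦ c ⟧
⟦⟧-∨ true  c exclusive rewrite exclusive refl = refl
⟦⟧-∨ false c exclusive = refl

⟦⟧-∨-≤ : ∀ b c → ⟦ b ∨ c ⟧ ≤ ⟦ b ⟧ + ⟦ c ⟧
⟦⟧-∨-≤ true  c = s≤s z≤n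
⟦⟧-∨-≤ false c = ≤-refl

⟦⟧-∧-not : ∀ p q s → ⟦ p ⟧ + ⟦ q ⟧ ≤ 1 + ⟦ s ⟧ + ⟦ p ∧ q ∧ not s ⟧
⟦⟧-∧-not true  true  true  = ≤-refl
⟦⟧-∧-not true  true  false = ≤-refl
⟦⟧-∧-not true  false s     = m≤m+n 1 _
⟦⟧-∧-not false q     s     = ≤-trans (⟦⟧≤1 q) (m≤m+n 1 _)

⟦⟧-∧-not-positive : ∀ p q s → 1 ≤ ⟦ p ∧ q ∧ not s ⟧ → (p ≡ true) × (q ≡ true) × (s ≡ false)
⟦⟧-∧-not-positive true  true  false _ = refl , refl , refl
⟦⟧-∧-not-positive true  true  true  ()
⟦⟧-∧-not-positive true  false s     ()
⟦⟧-∧-not-positive false q     s     ()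

module _ {A : Set} where

  sumMap : (A → ℕ) → List A → ℕ
  sumMap q xs = sum (map q xs)

  sumMap-++ : ∀ q xs ys → sumMap q (xs ++ ys) ≡ sumMap q xs + sumMap q ys
  sumMap-++ q xs ys = trans (cong sum (map-++ q xs ys)) (sum-++ (map q xs) (map q ys))

  sumMap-↭ : ∀ q {xs ys} → xs ↭ ys → sumMap q xs ≡ sumMap q ys
  sumMap-↭ q xs↭ys = sum-↭ (map⁺ q xs↭ys)

  sumMap-const-1 : ∀ xs → sumMap (λ _ → 1) xs ≡ length xs
  sumMap-const-1 []       = refl
  sumMap-const-1 (x ∷ xs) = cong suc (sumMap-const-1 xs)

  sumMap-cong : ∀ {q₁ q₂ : A → ℕ} → (∀ x → q₁ x ≡ q₂ x) → ∀ xs → sumMap q₁ xs ≡ sumMap q₂ xs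
  sumMap-cong q₁≡q₂ []       = refl
  sumMap-cong q₁≡q₂ (x ∷ xs) = cong₂ _+_ (q₁≡q₂ x) (sumMap-cong q₁≡q₂ xs)

  sumMap-mono : ∀ {q₁ q₂ : A → ℕ} → (∀ x → q₁ x ≤ q₂ x) → ∀ xs → sumMap q₁ xs ≤ sumMap q₂ xs
  sumMap-mono q₁≤q₂ []       = z≤n
  sumMap-mono q₁≤q₂ (x ∷ xs) = +-mono-≤ (q₁≤q₂ x) (sumMap-mono q₁≤q₂ xs)

  sumMap-const-0 : ∀ xs → sumMap (λ (_ : A) → 0) xs ≡ 0
  sumMap-const-0 []       = refl
  sumMap-const-0 (x ∷ xs) = sumMap-const-0 xs

  sumMap-+ : ∀ (q₁ q₂ : A → ℕ) xs → sumMap (λ x → q₁ x + q₂ x) xs ≡ sumMap q₁ xs + sumMap q₂ xs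
  sumMap-+ q₁ q₂ []       = refl
  sumMap-+ q₁ q₂ (x ∷ xs) =
    trans (cong (q₁ x + q₂ x +_) (sumMap-+ q₁ q₂ xs)) (shuffle (q₁ x) (q₂ x) (sumMap q₁ xs) (sumMap q₂ xs))
    where
      shuffle : ∀ a b c d → a + b + (c + d) ≡ a + c + (b + d)
      shuffle = solve-∀

  sumMap-*ʳ : ∀ (q : A → ℕ) c xs → sumMap (λ x → q x * c) xs ≡ sumMap q xs * c
  sumMap-*ʳ q c []       = refl
  sumMap-*ʳ q c (x ∷ xs) = trans (cong (q x * c +_) (sumMap-*ʳ q c xs)) (sym (*-distribʳ-+ c (q x) _))

sumMap-swap : ∀ {A B : Set} (F : A → B → ℕ) xs ys →
              sumMap (λ x → sumMap (F x) ys) xs ≡ sumMap (λ y → sumMap (λ x → F x y) xs) ys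
sumMap-swap F []       ys = sym (sumMap-const-0 ys)
sumMap-swap F (x ∷ xs) ys =
  trans (cong (sumMap (F x) ys +_) (sumMap-swap F xs ys)) (sym (sumMap-+ (F x) _ ys))

sumMap≡0⇒≡0 : ∀ {A : Set} (q : A → ℕ) xs → sumMap q xs ≡ 0 → ∀ {x} → x ∈ xs → q x ≡ 0
sumMap≡0⇒≡0 q (y ∷ ys) vanishes (here refl) = m+n≡0⇒m≡0 (q y) vanishes
sumMap≡0⇒≡0 q (y ∷ ys) vanishes (there x∈ys) = sumMap≡0⇒≡0 q ys (m+n≡0⇒n≡0 (q y) vanishes) x∈ys

sumFin : ∀ {n} → (Fin n → ℕ) → ℕ
sumFin {n} q = sumMap q (allFin n)

module _ {n : ℕ} where

  sumFin-cong : ∀ {q₁ q₂ : Fin n → ℕ} → (∀ x → q₁ x ≡ q₂ x) → sumFin q₁ ≡ sumFin q₂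
  sumFin-cong q₁≡q₂ = sumMap-cong q₁≡q₂ (allFin n)

  sumFin-const-1 : sumFin {n} (λ _ → 1) ≡ n
  sumFin-const-1 = trans (sumMap-const-1 (allFin n)) (length-tabulate id)

  sumFin-const : ∀ c → sumFin {n} (λ _ → c) ≡ n * c
  sumFin-const c = begin
    sumFin {n} (λ _ → c)      ≡⟨ sumFin-cong (λ _ → sym (*-identityˡ c)) ⟩
    sumFin {n} (λ _ → 1 * c)  ≡⟨ sumMap-*ʳ (λ _ → 1) c (allFin n) ⟩
    sumFin {n} (λ _ → 1) * c  ≡⟨ cong (_* c) sumFin-const-1 ⟩
    n * c                     ∎
    where open ≡-Reasoning

sumFin-suc : ∀ {n} (q : Fin (suc n) → ℕ) → sumFin q ≡ q fzero + sumFin (q ∘ fsuc)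
sumFin-suc q =
  cong (q fzero +_) (cong sum (trans (map-tabulate fsuc q) (sym (map-tabulate id (q ∘ fsuc)))))

sumFin-snoc : ∀ {k} (q : Fin (suc k) → ℕ) → sumFin q ≡ sumFin (q ∘ inject₁) + q (fromℕ k)
sumFin-snoc {zero}  q = +-comm (q fzero) 0
sumFin-snoc {suc k} q = begin
  sumFin q                                                   ≡⟨ sumFin-suc q ⟩
  q fzero + sumFin (q ∘ fsuc)                                ≡⟨ cong (q fzero +_) (sumFin-snoc (q ∘ fsuc)) ⟩
  q fzero + (sumFin (q ∘ fsuc ∘ inject₁) + q (fromℕ (suc k))) ≡⟨ sym (+-assoc (q fzero) _ _) ⟩
  q fzero + sumFin (q ∘ fsuc ∘ inject₁) + q (fromℕ (suc k))   ≡⟨ cong (_+ q (fromℕ (suc k))) (sumFin-suc (q ∘ inject₁)) ⟨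
  sumFin (q ∘ inject₁) + q (fromℕ (suc k))                    ∎
  where open ≡-Reasoning

size : ∀ {n} → (Fin n → Bool) → ℕ
size S = sumFin (λ a → ⟦ S a ⟧)

-- Weights along paths and cycles

module _ {A : Set} where

  pathSum : (A → A → ℕ) → A → List A → ℕ
  pathSum h a []       = 0
  pathSum h a (b ∷ bs) = h a b + pathSum h b bs

  endpoint : A → List A → A
  endpoint a []       = a
  endpoint a (b ∷ bs) = endpoint b bs

  cycleSum : (A → A → ℕ) → List A → ℕ
  cycleSum h []       = 0
  cycleSum h (a ∷ xs) = pathSum h a xs + h (endpoint a xs) a

  SymmetricWeight : (A → A → ℕ) → Set
  SymmetricWeight h = ∀ a b → h a b ≡ h b a

  endpoint-++ : ∀ a xs ys → endpoint a (xs ++ ys) ≡ endpoint (endpoint a xs) ys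
  endpoint-++ a []       ys = refl
  endpoint-++ a (x ∷ xs) ys = endpoint-++ x xs ys

  endpoint-snoc : ∀ a xs b → endpoint a (xs ++ [ b ]) ≡ b
  endpoint-snoc a xs b = endpoint-++ a xs [ b ]

  pathSum-++ : ∀ h a xs ys → pathSum h a (xs ++ ys) ≡ pathSum h a xs + pathSum h (endpoint a xs) ys
  pathSum-++ h a []       ys = refl
  pathSum-++ h a (x ∷ xs) ys =
    trans (cong (h a x +_) (pathSum-++ h x xs ys)) (sym (+-assoc (h a x) _ _))

  pathSum-reverse : ∀ h → SymmetricWeight h → ∀ x xs y →
                    pathSum h x (xs ++ [ y ]) ≡ pathSum h y (reverse xs ++ [ x ])
  pathSum-reverse h h-sym x []        y = cong (_+ 0) (h-sym x y)
  pathSum-reverse h h-sym x (x′ ∷ xs) y = begin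
    h x x′ + pathSum h x′ (xs ++ [ y ])
      ≡⟨ cong₂ _+_ (h-sym x x′) (pathSum-reverse h h-sym x′ xs y) ⟩
    h x′ x + pathSum h y (reverse xs ++ [ x′ ])
      ≡⟨ cong (h x′ x +_) (pathSum-++ h y (reverse xs) [ x′ ]) ⟩
    h x′ x + (p + (h e x′ + 0))
      ≡⟨ shuffle (h x′ x) p (h e x′) ⟩
    p + (h e x′ + (h x′ x + 0))
      ≡⟨ sym (pathSum-++ h y (reverse xs) (x′ ∷ [ x ])) ⟩
    pathSum h y (reverse xs ++ x′ ∷ [ x ])
      ≡⟨ cong (pathSum h y) (sym (++-assoc (reverse xs) [ x′ ] [ x ])) ⟩
    pathSum h y ((reverse xs ++ [ x′ ]) ++ [ x ])
      ≡⟨ cong (λ ys → pathSum h y (ys ++ [ x ])) (sym (unfold-reverse x′ xs)) ⟩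
    pathSum h y (reverse (x′ ∷ xs) ++ [ x ])
      ∎
    where
      open ≡-Reasoning
      p = pathSum h y (reverse xs)
      e = endpoint y (reverse xs)
      shuffle : ∀ a b c → a + (b + (c + 0)) ≡ b + (c + (a + 0))
      shuffle = solve-∀

  pathSum-+ : ∀ h₁ h₂ a xs → pathSum (λ u v → h₁ u v + h₂ u v) a xs ≡ pathSum h₁ a xs + pathSum h₂ a xs
  pathSum-+ h₁ h₂ a []       = refl
  pathSum-+ h₁ h₂ a (b ∷ bs) = trans (cong (h₁ a b + h₂ a b +_) (pathSum-+ h₁ h₂ b bs))
                                 (shuffle (h₁ a b) (h₂ a b) (pathSum h₁ b bs) (pathSum h₂ b bs))
    where
      shuffle : ∀ a b c d → a + b + (c + d) ≡ a + c + (b + d)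
      shuffle = solve-∀

  pathSum-mono : ∀ {h₁ h₂} → (∀ u v → h₁ u v ≤ h₂ u v) → ∀ a xs → pathSum h₁ a xs ≤ pathSum h₂ a xs
  pathSum-mono h₁≤h₂ a []       = z≤n
  pathSum-mono h₁≤h₂ a (b ∷ bs) = +-mono-≤ (h₁≤h₂ a b) (pathSum-mono h₁≤h₂ b bs)

  pathSum-second : ∀ q a xs → pathSum (λ _ v → q v) a xs ≡ sumMap q xs
  pathSum-second q a []       = refl
  pathSum-second q a (b ∷ bs) = cong (q b +_) (pathSum-second q b bs)

  pathSum-first : ∀ q a xs → pathSum (λ u _ → q u) a xs + q (endpoint a xs) ≡ q a + sumMap q xs
  pathSum-first q a []       = sym (+-identityʳ (q a))
  pathSum-first q a (b ∷ bs) = trans (+-assoc (q a) _ _) (cong (q a +_) (pathSum-first q b bs))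

  pathSum-positive⇒split : ∀ h a xs → 1 ≤ pathSum h a xs →
    ∃ λ P → ∃ λ b → ∃ λ c → ∃ λ Q → (a ∷ xs ≡ P ++ b ∷ c ∷ Q) × (1 ≤ h b c)
  pathSum-positive⇒split h a (b ∷ bs) pos with h a b in eq
  ... | suc _ = [] , a , b , bs , refl , subst (1 ≤_) (sym eq) (s≤s z≤n)
  ... | zero with pathSum-positive⇒split h b bs pos
  ...   | P , c , d , Q , split , hcd = a ∷ P , c , d , Q , cong (a ∷_) split , hcd

  cycleSum-++-comm : ∀ h P Q → cycleSum h (P ++ Q) ≡ cycleSum h (Q ++ P)
  cycleSum-++-comm h []      Q       = cong (cycleSum h) (sym (++-identityʳ Q))
  cycleSum-++-comm h (p ∷ P) []      = cong (cycleSum h) (++-identityʳ (p ∷ P))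
  cycleSum-++-comm h (p ∷ P) (q ∷ Q)
    rewrite pathSum-++ h p P (q ∷ Q) | pathSum-++ h q Q (p ∷ P)
          | endpoint-++ p P (q ∷ Q) | endpoint-++ q Q (p ∷ P)
    = shuffle (pathSum h p P) (h (endpoint p P) q) (pathSum h q Q) (h (endpoint q Q) p)
    where
      shuffle : ∀ a b c d → a + (b + c) + d ≡ c + (d + a) + b
      shuffle = solve-∀

  cycleSum-cut : ∀ h P a y Q → cycleSum h (P ++ a ∷ y ∷ Q) ≡ pathSum h y (Q ++ P ++ [ a ]) + h a y
  cycleSum-cut h P a y Q = begin
    cycleSum h (P ++ a ∷ y ∷ Q)      ≡⟨ cong (cycleSum h) (sym (++-assoc P [ a ] (y ∷ Q))) ⟩
    cycleSum h ((P ++ [ a ]) ++ y ∷ Q) ≡⟨ cycleSum-++-comm h (P ++ [ a ]) (y ∷ Q) ⟩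
    cycleSum h (y ∷ Q ++ P ++ [ a ]) ≡⟨ cong (λ e → pathSum h y (Q ++ P ++ [ a ]) + h e y) last≡a ⟩
    pathSum h y (Q ++ P ++ [ a ]) + h a y ∎
    where
      open ≡-Reasoning
      last≡a : endpoint y (Q ++ P ++ [ a ]) ≡ a
      last≡a = trans (endpoint-++ y Q (P ++ [ a ])) (endpoint-snoc _ P a)

  cycleSum-segment : ∀ h P a b Q → h a b ≤ cycleSum h (P ++ a ∷ b ∷ Q)
  cycleSum-segment h P a b Q rewrite cycleSum-cut h P a b Q = m≤n+m (h a b) _

  cycleSum-posaRotation : ∀ h → SymmetricWeight h → ∀ x₀ A a b B →
    cycleSum h (x₀ ∷ b ∷ B ++ a ∷ reverse A) + h a b + h (endpoint b B) x₀
      ≡ cycleSum h (x₀ ∷ A ++ a ∷ b ∷ B) + h x₀ b + h (endpoint b B) a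
  cycleSum-posaRotation h h-sym x₀ A a b B
    rewrite pathSum-++ h x₀ A (a ∷ b ∷ B) | endpoint-++ x₀ A (a ∷ b ∷ B)
          | pathSum-++ h b B (a ∷ reverse A) | endpoint-++ b B (a ∷ reverse A)
    = trans (regroup₁ r s t u v w z)
        (trans (cong (_+ (t + u + v + w + z)) (sym reversed)) (regroup₂ p q t u v w z))
    where
      p = pathSum h x₀ A
      q = h (endpoint x₀ A) a
      r = pathSum h a (reverse A)
      s = h (endpoint a (reverse A)) x₀
      t = h x₀ b
      u = pathSum h b B
      v = h (endpoint b B) a
      w = h a b
      z = h (endpoint b B) x₀
      reversed : p + q ≡ r + s
      reversed = begin
        p + q                                  ≡⟨ cong (p +_) (sym (+-identityʳ q)) ⟩
        p + (q + 0)                            ≡⟨ sym (pathSum-++ h x₀ A [ a ]) ⟩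
        pathSum h x₀ (A ++ [ a ])              ≡⟨ pathSum-reverse h h-sym x₀ A a ⟩
        pathSum h a (reverse A ++ [ x₀ ])      ≡⟨ pathSum-++ h a (reverse A) [ x₀ ] ⟩
        r + (s + 0)                            ≡⟨ cong (r +_) (+-identityʳ s) ⟩
        r + s                                  ∎
        where open ≡-Reasoning
      regroup₁ : ∀ r s t u v w z → t + (u + (v + r)) + s + w + z ≡ r + s + (t + u + v + w + z)
      regroup₁ = solve-∀
      regroup₂ : ∀ p q t u v w z → p + q + (t + u + v + w + z) ≡ p + (q + (w + u)) + z + t + v
      regroup₂ = solve-∀

  cycleSum-move : ∀ h x P a b Q c W → c ∷ W ≡ P ++ a ∷ b ∷ Q →
    cycleSum h (P ++ a ∷ x ∷ b ∷ Q) + h a b + h x c + h (endpoint c W) x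
      ≡ cycleSum h (x ∷ c ∷ W) + h x b + h a x + h (endpoint c W) c
  cycleSum-move h x P a b Q c W split = begin
    cycleSum h (P ++ a ∷ x ∷ b ∷ Q) + h a b + h x c + h z x
      ≡⟨ cong (λ s → s + h a b + h x c + h z x) (cycleSum-cut h P a x (b ∷ Q)) ⟩
    h x b + K + h a x + h a b + h x c + h z x
      ≡⟨ regroup₁ (h x b) K (h a x) (h a b) (h x c) (h z x) ⟩
    K + h a b + (h x b + h a x + h x c + h z x)
      ≡⟨ cong (_+ (h x b + h a x + h x c + h z x)) (sym closed) ⟩
    pathSum h c W + h z c + (h x b + h a x + h x c + h z x)
      ≡⟨ regroup₂ (h x b) (pathSum h c W) (h a x) (h z c) (h x c) (h z x) ⟩
    cycleSum h (x ∷ c ∷ W) + h x b + h a x + h z c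
      ∎
    where
      open ≡-Reasoning
      z = endpoint c W
      K = pathSum h b (Q ++ P ++ [ a ])
      closed : pathSum h c W + h z c ≡ K + h a b
      closed = trans (cong (cycleSum h) split) (cycleSum-cut h P a b Q)
      regroup₁ : ∀ t K u w v z → t + K + u + w + v + z ≡ K + w + (t + u + v + z)
      regroup₁ = solve-∀
      regroup₂ : ∀ t Pc u zc v z → Pc + zc + (t + u + v + z) ≡ v + Pc + z + t + u + zc
      regroup₂ = solve-∀

  SamePair : A → A → A → A → Set
  SamePair u v a b = (a ≡ u × b ≡ v) ⊎ (a ≡ v × b ≡ u)

  Switched : (v₁ v₂ v₃ v₄ v₅ : A) → List A → List A → Set
  Switched v₁ v₂ v₃ v₄ v₅ L L′ = ∀ h → SymmetricWeight h →
    cycleSum h L′ + (h v₁ v₂ + h v₁ v₃ + h v₄ v₅) ≡ cycleSum h L + (h v₁ v₄ + h v₁ v₅ + h v₂ v₃)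

  private
    rotate₃ : ∀ p q r → p + q + r ≡ q + r + p
    rotate₃ = solve-∀
    swap₁₂ : ∀ p q r → p + q + r ≡ q + p + r
    swap₁₂ = solve-∀
    reverse₃ : ∀ p q r → p + q + r ≡ r + q + p
    reverse₃ = solve-∀

  bowtieWeights-relabel : ∀ h → SymmetricWeight h → ∀ {x c z a b u₂ u₃ u₄ u₅ : A} →
    SamePair u₂ u₃ c z → SamePair u₄ u₅ a b →
    (h a b + h x c + h z x ≡ h x u₂ + h x u₃ + h u₄ u₅) × (h x b + h a x + h z c ≡ h x u₄ + h x u₅ + h u₂ u₃)
  bowtieWeights-relabel h h-sym {x} {u₂ = u₂} {u₃} {u₄} {u₅} (inj₁ (refl , refl)) (inj₁ (refl , refl)) =
    trans (cong (h u₄ u₅ + h x u₂ +_) (h-sym u₃ x)) (rotate₃ (h u₄ u₅) (h x u₂) (h x u₃)) ,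
    trans (cong₂ (λ s t → h x u₅ + s + t) (h-sym u₄ x) (h-sym u₃ u₂)) (swap₁₂ (h x u₅) (h x u₄) (h u₂ u₃))
  bowtieWeights-relabel h h-sym {x} {u₂ = u₂} {u₃} {u₄} {u₅} (inj₁ (refl , refl)) (inj₂ (refl , refl)) =
    trans (cong₂ (λ s t → s + h x u₂ + t) (h-sym u₅ u₄) (h-sym u₃ x)) (rotate₃ (h u₄ u₅) (h x u₂) (h x u₃)) ,
    cong₂ (λ s t → h x u₄ + s + t) (h-sym u₅ x) (h-sym u₃ u₂)
  bowtieWeights-relabel h h-sym {x} {u₂ = u₂} {u₃} {u₄} {u₅} (inj₂ (refl , refl)) (inj₁ (refl , refl)) =
    trans (cong (h u₄ u₅ + h x u₃ +_) (h-sym u₂ x)) (reverse₃ (h u₄ u₅) (h x u₃) (h x u₂)) ,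
    trans (cong (λ s → h x u₅ + s + h u₂ u₃) (h-sym u₄ x)) (swap₁₂ (h x u₅) (h x u₄) (h u₂ u₃))
  bowtieWeights-relabel h h-sym {x} {u₂ = u₂} {u₃} {u₄} {u₅} (inj₂ (refl , refl)) (inj₂ (refl , refl)) =
    trans (cong₂ (λ s t → s + h x u₃ + t) (h-sym u₅ u₄) (h-sym u₂ x)) (reverse₃ (h u₄ u₅) (h x u₃) (h x u₂)) ,
    cong (λ s → h x u₄ + s + h u₂ u₃) (h-sym u₅ x)

  switched-move : ∀ x c W P a b Q {u₂ u₃ u₄ u₅ : A} → c ∷ W ≡ P ++ a ∷ b ∷ Q →
    SamePair u₂ u₃ c (endpoint c W) → SamePair u₄ u₅ a b →
    Switched x u₂ u₃ u₄ u₅ (x ∷ c ∷ W) (P ++ a ∷ x ∷ b ∷ Q)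
  switched-move x c W P a b Q {u₂} {u₃} {u₄} {u₅} split ends ab h h-sym = begin
    cycleSum h L′ + (h x u₂ + h x u₃ + h u₄ u₅)
      ≡⟨ cong (cycleSum h L′ +_) (sym (proj₁ relabel)) ⟩
    cycleSum h L′ + (h a b + h x c + h z x)
      ≡⟨ regroup (cycleSum h L′) _ _ _ ⟩
    cycleSum h L′ + h a b + h x c + h z x
      ≡⟨ cycleSum-move h x P a b Q c W split ⟩
    cycleSum h (x ∷ c ∷ W) + h x b + h a x + h z c
      ≡⟨ sym (regroup (cycleSum h (x ∷ c ∷ W)) _ _ _) ⟩
    cycleSum h (x ∷ c ∷ W) + (h x b + h a x + h z c)
      ≡⟨ cong (cycleSum h (x ∷ c ∷ W) +_) (proj₂ relabel) ⟩
    cycleSum h (x ∷ c ∷ W) + (h x u₄ + h x u₅ + h u₂ u₃)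
      ∎
    where
      open ≡-Reasoning
      L′ = P ++ a ∷ x ∷ b ∷ Q
      z = endpoint c W
      relabel = bowtieWeights-relabel h h-sym ends ab
      regroup : ∀ p q r s → p + (q + r + s) ≡ p + q + r + s
      regroup = solve-∀

  move-↭ : ∀ (x c : A) W P a b Q → c ∷ W ≡ P ++ a ∷ b ∷ Q → x ∷ c ∷ W ↭ P ++ a ∷ x ∷ b ∷ Q
  move-↭ x c W P a b Q split = begin
    x ∷ c ∷ W                 ≡⟨ cong (x ∷_) split ⟩
    x ∷ P ++ a ∷ b ∷ Q        ↭⟨ shift x P (a ∷ b ∷ Q) ⟨
    P ++ x ∷ a ∷ b ∷ Q        ↭⟨ ++⁺ˡ P (swap x a ↭-refl) ⟩
    P ++ a ∷ x ∷ b ∷ Q        ∎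
    where open PermutationReasoning

module _ {n : ℕ} where

  _≡ᵇ_ : Fin n → Fin n → Bool
  a ≡ᵇ b = does (a ≟ b)

  ≡ᵇ-refl : ∀ a → (a ≡ᵇ a) ≡ true
  ≡ᵇ-refl a with a ≟ a
  ... | yes _  = refl
  ... | no a≢a = ⊥-elim (a≢a refl)

  ≡ᵇ-sym : ∀ a b → (a ≡ᵇ b) ≡ (b ≡ᵇ a)
  ≡ᵇ-sym a b with a ≟ b | b ≟ a
  ... | yes _   | yes _   = refl
  ... | no _    | no _    = refl
  ... | yes a≡b | no b≢a  = ⊥-elim (b≢a (sym a≡b))
  ... | no a≢b  | yes b≡a = ⊥-elim (a≢b (sym b≡a))

  ≡ᵇ-true⇒≡ : ∀ {a b} → (a ≡ᵇ b) ≡ true → a ≡ b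
  ≡ᵇ-true⇒≡ {a} {b} eq with a ≟ b
  ... | yes a≡b = a≡b

  ≢⇒≡ᵇ-false : ∀ {a b} → a ≢ b → (a ≡ᵇ b) ≡ false
  ≢⇒≡ᵇ-false {a} {b} a≢b with a ≟ b
  ... | yes a≡b = ⊥-elim (a≢b a≡b)
  ... | no _    = refl

  ≡ᵇ-false⇒≢ : ∀ {a b} → (a ≡ᵇ b) ≡ false → a ≢ b
  ≡ᵇ-false⇒≢ {a} eq refl with trans (sym eq) (≡ᵇ-refl a)
  ... | ()

sumFin-point : ∀ {n} (a : Fin n) (q : Fin n → ℕ) → sumFin (λ v → ⟦ a ≡ᵇ v ⟧ * q v) ≡ q a
sumFin-point {suc n} fzero q = begin
  sumFin (λ v → ⟦ fzero ≡ᵇ v ⟧ * q v)  ≡⟨ sumFin-suc (λ v → ⟦ fzero ≡ᵇ v ⟧ * q v) ⟩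
  q fzero + 0 + sumFin {n} (λ _ → 0)   ≡⟨ cong (q fzero + 0 +_) (sumMap-const-0 (allFin n)) ⟩
  q fzero + 0 + 0                      ≡⟨ trans (+-identityʳ _) (+-identityʳ _) ⟩
  q fzero                              ∎
  where open ≡-Reasoning
sumFin-point {suc n} (fsuc a) q =
  trans (sumFin-suc (λ v → ⟦ fsuc a ≡ᵇ v ⟧ * q v)) (sumFin-point a (q ∘ fsuc))

module _ {n : ℕ} where

  occurrences : Fin n → List (Fin n) → ℕ
  occurrences v = sumMap (λ a → ⟦ a ≡ᵇ v ⟧)

  record Enumeration (L : List (Fin n)) : Set where
    constructor enumeration
    field occurs-once : ∀ v → occurrences v L ≡ 1

  open Enumeration public

  enumeration-↭ : ∀ {L L′} → Enumeration L → L ↭ L′ → Enumeration L′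
  enumeration-↭ enum L↭L′ = enumeration λ v → trans (sym (sumMap-↭ _ L↭L′)) (occurs-once enum v)

  sumMap-enumeration : ∀ {L} → Enumeration L → ∀ q → sumMap q L ≡ sumFin q
  sumMap-enumeration {L} enum q = begin
    sumMap q L
      ≡⟨ sumMap-cong (λ x → sym (sumFin-point x q)) L ⟩
    sumMap (λ x → sumFin (λ v → ⟦ x ≡ᵇ v ⟧ * q v)) L
      ≡⟨ sumMap-swap (λ x v → ⟦ x ≡ᵇ v ⟧ * q v) L (allFin n) ⟩
    sumFin (λ v → sumMap (λ x → ⟦ x ≡ᵇ v ⟧ * q v) L)
      ≡⟨ sumFin-cong (λ v → sumMap-*ʳ (λ x → ⟦ x ≡ᵇ v ⟧) (q v) L) ⟩
    sumFin (λ v → occurrences v L * q v)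
      ≡⟨ sumFin-cong (λ v → trans (cong (_* q v) (occurs-once enum v)) (*-identityˡ (q v))) ⟩
    sumFin q
      ∎
    where open ≡-Reasoning

  enumeration-length : ∀ {L} → Enumeration L → length L ≡ n
  enumeration-length {L} enum =
    trans (sym (sumMap-const-1 L)) (trans (sumMap-enumeration enum (λ _ → 1)) sumFin-const-1)

  infix 4 _∈ᵇ_
  _∈ᵇ_ : Fin n → List (Fin n) → Bool
  v ∈ᵇ xs = any (_≡ᵇ v) xs

  ∈⇒∈ᵇ : ∀ {v xs} → v ∈ xs → (v ∈ᵇ xs) ≡ true
  ∈⇒∈ᵇ {v} {x ∷ xs} (here refl) = cong (_∨ (v ∈ᵇ xs)) (≡ᵇ-refl v)
  ∈⇒∈ᵇ {v} {x ∷ xs} (there v∈xs) = trans (cong ((x ≡ᵇ v) ∨_) (∈⇒∈ᵇ v∈xs)) (∨-zeroʳ (x ≡ᵇ v))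

  ∈ᵇ⇒∈ : ∀ {v} xs → (v ∈ᵇ xs) ≡ true → v ∈ xs
  ∈ᵇ⇒∈ {v} (x ∷ xs) v∈ᵇx∷xs with x ≡ᵇ v in x≡v
  ... | true  = here (sym (≡ᵇ-true⇒≡ x≡v))
  ... | false = there (∈ᵇ⇒∈ xs v∈ᵇx∷xs)

  ∉ᵇ⇒All≢ : ∀ {v} xs → (v ∈ᵇ xs) ≡ false → All (v ≢_) xs
  ∉ᵇ⇒All≢ []       _     = []
  ∉ᵇ⇒All≢ {v} (x ∷ xs) v∉x∷xs with x ≡ᵇ v in x≡v
  ... | false = ≢-sym (≡ᵇ-false⇒≢ x≡v) ∷ ∉ᵇ⇒All≢ xs v∉x∷xs

  All≢⇒∉ᵇ : ∀ {v xs} → All (v ≢_) xs → (v ∈ᵇ xs) ≡ false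
  All≢⇒∉ᵇ []             = refl
  All≢⇒∉ᵇ (v≢x ∷ v≢xs) = cong₂ _∨_ (≢⇒≡ᵇ-false (≢-sym v≢x)) (All≢⇒∉ᵇ v≢xs)

  occurrences-unique : ∀ {xs} → Unique xs → ∀ v → occurrences v xs ≡ ⟦ v ∈ᵇ xs ⟧
  occurrences-unique {[]}     []                 v = refl
  occurrences-unique {x ∷ xs} (x≢xs ∷ unique) v =
    trans (cong (⟦ x ≡ᵇ v ⟧ +_) (occurrences-unique unique v))
          (sym (⟦⟧-∨ (x ≡ᵇ v) (v ∈ᵇ xs) λ x≡v → subst (λ y → (y ∈ᵇ xs) ≡ false) (≡ᵇ-true⇒≡ x≡v) (All≢⇒∉ᵇ x≢xs)))

  occurrences-filterᵇ : ∀ (p : Fin n → Bool) v xs →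
                        occurrences v (filterᵇ p xs) ≡ sumMap (λ a → ⟦ p a ⟧ * ⟦ a ≡ᵇ v ⟧) xs
  occurrences-filterᵇ p v []       = refl
  occurrences-filterᵇ p v (x ∷ xs) with p x
  ... | true  = cong₂ _+_ (sym (+-identityʳ ⟦ x ≡ᵇ v ⟧)) (occurrences-filterᵇ p v xs)
  ... | false = occurrences-filterᵇ p v xs

  occurrences-filterᵇ-allFin : ∀ (p : Fin n → Bool) v → occurrences v (filterᵇ p (allFin n)) ≡ ⟦ p v ⟧
  occurrences-filterᵇ-allFin p v = begin
    occurrences v (filterᵇ p (allFin n))
      ≡⟨ occurrences-filterᵇ p v (allFin n) ⟩
    sumFin (λ a → ⟦ p a ⟧ * ⟦ a ≡ᵇ v ⟧)
      ≡⟨ sumFin-cong (λ a → trans (*-comm ⟦ p a ⟧ _) (cong (λ e → ⟦ e ⟧ * ⟦ p a ⟧) (≡ᵇ-sym a v))) ⟩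
    sumFin (λ a → ⟦ v ≡ᵇ a ⟧ * ⟦ p a ⟧)
      ≡⟨ sumFin-point v (λ a → ⟦ p a ⟧) ⟩
    ⟦ p v ⟧
      ∎
    where open ≡-Reasoning

  size-∈ᵇ : ∀ xs → size (_∈ᵇ xs) ≤ length xs
  size-∈ᵇ []       = ≤-reflexive (sumMap-const-0 (allFin n))
  size-∈ᵇ (x ∷ xs) = begin
    sumFin (λ v → ⟦ (x ≡ᵇ v) ∨ (v ∈ᵇ xs) ⟧)
      ≤⟨ sumMap-mono (λ v → ⟦⟧-∨-≤ (x ≡ᵇ v) (v ∈ᵇ xs)) (allFin n) ⟩
    sumFin (λ v → ⟦ x ≡ᵇ v ⟧ + ⟦ v ∈ᵇ xs ⟧)
      ≡⟨ sumMap-+ (λ v → ⟦ x ≡ᵇ v ⟧) (λ v → ⟦ v ∈ᵇ xs ⟧) (allFin n) ⟩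
    sumFin (λ v → ⟦ x ≡ᵇ v ⟧) + size (_∈ᵇ xs)
      ≡⟨ cong (_+ size (_∈ᵇ xs)) single ⟩
    1 + size (_∈ᵇ xs)
      ≤⟨ +-monoʳ-≤ 1 (size-∈ᵇ xs) ⟩
    suc (length xs)
      ∎
    where
      open ≤-Reasoning
      single : sumFin (λ v → ⟦ x ≡ᵇ v ⟧) ≡ 1
      single = trans (sumFin-cong (λ v → sym (*-identityʳ ⟦ x ≡ᵇ v ⟧))) (sumFin-point x (λ _ → 1))

  lookup-occurrence : ∀ (v : Fin n) L → 1 ≤ occurrences v L → Σ (Fin (length L)) λ i → lookup L i ≡ v
  lookup-occurrence v (x ∷ L) pos with x ≡ᵇ v in x≡v
  ... | true  = fzero , ≡ᵇ-true⇒≡ x≡v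
  ... | false with lookup-occurrence v L pos
  ...   | i , found = fsuc i , found

  occurrences-lookup : ∀ (L : List (Fin n)) i → 1 ≤ occurrences (lookup L i) L
  occurrences-lookup (x ∷ L) fzero    rewrite ≡ᵇ-refl x = s≤s z≤n
  occurrences-lookup (x ∷ L) (fsuc i) = ≤-trans (occurrences-lookup L i) (m≤n+m _ _)

  occurs-once-at-head : ∀ (x : Fin n) L → occurrences x (x ∷ L) ≤ 1 → ¬ 1 ≤ occurrences x L
  occurs-once-at-head x L once pos
    with ≤-trans pos (≤-pred (subst (_≤ 1) (cong (λ e → ⟦ e ⟧ + occurrences x L) (≡ᵇ-refl x)) once))
  ... | ()

  lookup-injective : ∀ (L : List (Fin n)) → (∀ v → occurrences v L ≤ 1) → ∀ i j → lookup L i ≡ lookup L j → i ≡ j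
  lookup-injective (x ∷ L) once fzero    fzero    _  = refl
  lookup-injective (x ∷ L) once fzero    (fsuc j) eq =
    ⊥-elim (occurs-once-at-head x L (once x) (subst (λ v → 1 ≤ occurrences v L) (sym eq) (occurrences-lookup L j)))
  lookup-injective (x ∷ L) once (fsuc i) fzero    eq =
    ⊥-elim (occurs-once-at-head x L (once x) (subst (λ v → 1 ≤ occurrences v L) eq (occurrences-lookup L i)))
  lookup-injective (x ∷ L) once (fsuc i) (fsuc j) eq =
    cong fsuc (lookup-injective L (λ v → ≤-trans (m≤n+m _ _) (once v)) i j eq)

module _ {n : ℕ} where

  pairIndicator : Fin n → Fin n → Fin n → Fin n → ℕ
  pairIndicator u v a b = ⟦ (a ≡ᵇ u ∧ b ≡ᵇ v) ∨ (a ≡ᵇ v ∧ b ≡ᵇ u) ⟧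

  Traverses : List (Fin n) → Fin n → Fin n → Set
  Traverses L u v = 1 ≤ cycleSum (pairIndicator u v) L

  pairIndicator-sym : ∀ u v → SymmetricWeight (pairIndicator u v)
  pairIndicator-sym u v a b = cong ⟦_⟧ (begin
    (a ≡ᵇ u ∧ b ≡ᵇ v) ∨ (a ≡ᵇ v ∧ b ≡ᵇ u)
      ≡⟨ cong₂ _∨_ (∧-comm (a ≡ᵇ u) (b ≡ᵇ v)) (∧-comm (a ≡ᵇ v) (b ≡ᵇ u)) ⟩
    (b ≡ᵇ v ∧ a ≡ᵇ u) ∨ (b ≡ᵇ u ∧ a ≡ᵇ v)
      ≡⟨ ∨-comm (b ≡ᵇ v ∧ a ≡ᵇ u) (b ≡ᵇ u ∧ a ≡ᵇ v) ⟩
    (b ≡ᵇ u ∧ a ≡ᵇ v) ∨ (b ≡ᵇ v ∧ a ≡ᵇ u)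
      ∎)
    where open ≡-Reasoning

  pairIndicator-positive : ∀ u v a b → 1 ≤ pairIndicator u v a b → SamePair u v a b
  pairIndicator-positive u v a b pos
    with a ≡ᵇ u in au | b ≡ᵇ v in bv | a ≡ᵇ v in av | b ≡ᵇ u in bu
  ... | true  | true  | _     | _    = inj₁ (≡ᵇ-true⇒≡ au , ≡ᵇ-true⇒≡ bv)
  ... | false | _     | true  | true = inj₂ (≡ᵇ-true⇒≡ av , ≡ᵇ-true⇒≡ bu)
  ... | true  | false | true  | true = inj₂ (≡ᵇ-true⇒≡ av , ≡ᵇ-true⇒≡ bu)
  pairIndicator-positive u v a b () | false | _     | true  | false
  pairIndicator-positive u v a b () | false | _     | false | _
  pairIndicator-positive u v a b () | true  | false | false | _
  pairIndicator-positive u v a b () | true  | false | true  | false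

  pairIndicator-zero : ∀ u v a b → ¬ SamePair u v a b → pairIndicator u v a b ≡ 0
  pairIndicator-zero u v a b different =
    n<1⇒n≡0 (≰⇒> (different ∘ pairIndicator-positive u v a b))

  pairIndicator-forward : ∀ u v → pairIndicator u v u v ≡ 1
  pairIndicator-forward u v rewrite ≡ᵇ-refl u | ≡ᵇ-refl v = refl

  pairIndicator-backward : ∀ u v → pairIndicator u v v u ≡ 1
  pairIndicator-backward u v rewrite ≡ᵇ-refl u | ≡ᵇ-refl v = cong ⟦_⟧ (∨-zeroʳ _)

  pairIndicator-avoid : ∀ {u v a} → a ≢ u → a ≢ v → ∀ b → pairIndicator u v a b ≡ 0
  pairIndicator-avoid {u} {v} {a} a≢u a≢v b = pairIndicator-zero u v a b λ
    { (inj₁ (a≡u , _)) → a≢u a≡u ; (inj₂ (a≡v , _)) → a≢v a≡v }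

  pairIndicator-outside : ∀ (S : Fin n → Bool) u v a b → S a ≡ false → S u ≡ true → S v ≡ true →
                          pairIndicator u v a b ≡ 0
  pairIndicator-outside S u v a b a∉S u∈S v∈S = pairIndicator-avoid (separated u∈S) (separated v∈S) b
    where
      separated : ∀ {x} → S x ≡ true → a ≢ x
      separated x∈S a≡x = false≢true (trans (sym a∉S) (trans (cong S a≡x) x∈S))

  occurrences-split : ∀ (v : Fin n) L → 1 ≤ occurrences v L → ∃ λ P → ∃ λ Q → L ≡ P ++ v ∷ Q
  occurrences-split v (x ∷ L) pos with x ≡ᵇ v in x≡v
  ... | true  = [] , L , cong (_∷ L) (≡ᵇ-true⇒≡ x≡v)
  ... | false with occurrences-split v L pos
  ...   | P , Q , refl = x ∷ P , Q , refl

  pathSum-avoiding : ∀ h (v : Fin n) c W → occurrences v (c ∷ W) ≡ 0 →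
                     (∀ a b → a ≢ v → b ≢ v → h a b ≡ 0) → pathSum h c W ≡ 0
  pathSum-avoiding h v c []      absent vanish = refl
  pathSum-avoiding h v c (d ∷ W) absent vanish with c ≡ᵇ v in c≡v | d ≡ᵇ v in d≡v
  ... | false | false = cong₂ _+_ (vanish c d (≡ᵇ-false⇒≢ c≡v) (≡ᵇ-false⇒≢ d≡v))
                                  (pathSum-avoiding h v d W (trans (cong (λ e → ⟦ e ⟧ + occurrences v W) d≡v) absent) vanish)

  cycleSum-around : ∀ x w c W → occurrences x (c ∷ W) ≡ 0 →
    cycleSum (pairIndicator x w) (x ∷ c ∷ W) ≡ pairIndicator x w x c + pairIndicator x w (endpoint c W) x
  cycleSum-around x w c W absent =
    cong (_+ pairIndicator x w (endpoint c W) x) (trans (cong (pairIndicator x w x c +_) middle) (+-identityʳ _))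
    where
      middle : pathSum (pairIndicator x w) c W ≡ 0
      middle = pathSum-avoiding (pairIndicator x w) x c W absent λ a b a≢x b≢x →
        pairIndicator-zero x w a b λ { (inj₁ (a≡x , _)) → a≢x a≡x ; (inj₂ (_ , b≡x)) → b≢x b≡x }

  traverses-neighbour : ∀ (x w c : Fin n) W → occurrences x (c ∷ W) ≡ 0 → x ≢ w →
                        Traverses (x ∷ c ∷ W) x w → (c ≡ w) ⊎ (endpoint c W ≡ w)
  traverses-neighbour x w c W absent x≢w traversed
    with 1≤+⇒ (pairIndicator x w x c) _ (subst (1 ≤_) (cycleSum-around x w c W absent) traversed)
  ... | inj₁ first with pairIndicator-positive x w x c first
  ...   | inj₁ (_ , c≡w) = inj₁ c≡w
  ...   | inj₂ (x≡w , _) = ⊥-elim (x≢w x≡w)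
  traverses-neighbour x w c W absent x≢w traversed | inj₂ last
    with pairIndicator-positive x w (endpoint c W) x last
  ...   | inj₁ (_ , x≡w) = ⊥-elim (x≢w x≡w)
  ...   | inj₂ (z≡w , _) = inj₂ z≡w

-- Pósa rotations

module Orderings {n : ℕ} (G : Graph n) where

  nonEdge : Fin n → Fin n → ℕ
  nonEdge a b = if adj G a b then 0 else 1

  nonEdge-sym : SymmetricWeight nonEdge
  nonEdge-sym a b rewrite Graph.sym G a b = refl

  nonEdge-positive : ∀ {a b} → 1 ≤ nonEdge a b → adj G a b ≡ false
  nonEdge-positive {a} {b} pos with adj G a b
  ... | false = refl

  nonEdge-zero : ∀ {a b} → nonEdge a b ≡ 0 → adj G a b ≡ true
  nonEdge-zero {a} {b} none with adj G a b
  ... | true = refl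

  defects : List (Fin n) → ℕ
  defects = cycleSum nonEdge

  MinDegreeSum : ℕ → Set
  MinDegreeSum k = ∀ u v → k ≤ degree G u + degree G v

  Keeps : (Fin n → Bool) → List (Fin n) → List (Fin n) → Set
  Keeps S L L′ = ∀ u v → S u ≡ true → S v ≡ true → adj G u v ≡ true →
                 cycleSum (pairIndicator u v) L ≤ cycleSum (pairIndicator u v) L′

  keeps-refl : ∀ {S L} → Keeps S L L
  keeps-refl _ _ _ _ _ = ≤-refl

  keeps-trans : ∀ {S L₁ L₂ L₃} → Keeps S L₁ L₂ → Keeps S L₂ L₃ → Keeps S L₁ L₃
  keeps-trans keeps₁₂ keeps₂₃ u v su sv uv = ≤-trans (keeps₁₂ u v su sv uv) (keeps₂₃ u v su sv uv)

  rotateToDefect : ∀ L → 1 ≤ defects L →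
    ∃ λ x₀ → ∃ λ xs → (∀ h → cycleSum h (x₀ ∷ xs) ≡ cycleSum h L) × (L ↭ x₀ ∷ xs)
                      × (adj G (endpoint x₀ xs) x₀ ≡ false)
  rotateToDefect (y ∷ ys) pos with adj G (endpoint y ys) y in closing
  ... | false = y , ys , (λ _ → refl) , ↭-refl , closing
  ... | true with pathSum-positive⇒split nonEdge y ys (subst (1 ≤_) (+-identityʳ _) pos)
  ...   | P , a , b , Q , split , gap =
    b , Q ++ P ++ [ a ] ,
    (λ h → trans (cong (λ e → pathSum h b (Q ++ P ++ [ a ]) + h e b) last≡a)
                 (trans (sym (cycleSum-cut h P a b Q)) (cong (cycleSum h) (sym split)))) ,
    subst (_↭ b ∷ Q ++ P ++ [ a ]) (trans (++-assoc P [ a ] (b ∷ Q)) (sym split)) (++-comm (P ++ [ a ]) (b ∷ Q)) ,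
    subst (λ e → adj G e b ≡ false) (sym last≡a) (nonEdge-positive gap)
    where
      last≡a : endpoint b (Q ++ P ++ [ a ]) ≡ a
      last≡a = trans (endpoint-++ b Q (P ++ [ a ])) (endpoint-snoc _ P a)

  -- For the path x₀ … a b … z, rotating at a candidate pair a b replaces the edge ab and the
  -- non-edge z x₀ by the edges x₀b and za, without touching an edge inside S.
  rotationCandidate : (Fin n → Bool) → Fin n → Fin n → Fin n → Fin n → ℕ
  rotationCandidate S x₀ z a b = ⟦ adj G x₀ b ∧ adj G a z ∧ not (S a) ⟧

  degree-along : ∀ {L} → Enumeration L → ∀ v → degree G v ≡ sumMap (λ a → ⟦ adj G v a ⟧) L
  degree-along enum v = sym (sumMap-enumeration enum (λ a → ⟦ adj G v a ⟧))

  degree-first : ∀ x₀ x₁ ys → Enumeration (x₀ ∷ x₁ ∷ ys) → degree G x₀ ≤ 1 + sumMap (λ b → ⟦ adj G x₀ b ⟧) ys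
  degree-first x₀ x₁ ys enum rewrite degree-along enum x₀ | Graph.irr G x₀ = +-monoˡ-≤ _ (⟦⟧≤1 (adj G x₀ x₁))

  degree-last : ∀ x₀ x₁ ys → Enumeration (x₀ ∷ x₁ ∷ ys) → adj G (endpoint x₁ ys) x₀ ≡ false →
                degree G (endpoint x₁ ys) ≤ pathSum (λ a _ → ⟦ adj G a (endpoint x₁ ys) ⟧) x₁ ys
  degree-last x₀ x₁ ys enum open-end = ≤-reflexive (begin
    degree G z
      ≡⟨ degree-along enum z ⟩
    ⟦ adj G z x₀ ⟧ + sumMap (λ a → ⟦ adj G z a ⟧) (x₁ ∷ ys)
      ≡⟨ cong (λ e → ⟦ e ⟧ + sumMap (λ a → ⟦ adj G z a ⟧) (x₁ ∷ ys)) open-end ⟩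
    sumMap (λ a → ⟦ adj G z a ⟧) (x₁ ∷ ys)
      ≡⟨ sumMap-cong (λ a → cong ⟦_⟧ (Graph.sym G z a)) (x₁ ∷ ys) ⟩
    sumMap (λ a → ⟦ adj G a z ⟧) (x₁ ∷ ys)
      ≡⟨ pathSum-first (λ a → ⟦ adj G a z ⟧) x₁ ys ⟨
    nbrs-z + ⟦ adj G z z ⟧
      ≡⟨ cong (λ e → nbrs-z + ⟦ e ⟧) (Graph.irr G z) ⟩
    nbrs-z + 0
      ≡⟨ +-identityʳ nbrs-z ⟩
    nbrs-z
      ∎)
    where
      open ≡-Reasoning
      z = endpoint x₁ ys
      nbrs-z = pathSum (λ a _ → ⟦ adj G a z ⟧) x₁ ys

  neighbours-along : ∀ S x₀ z x₁ ys →
    sumMap (λ b → ⟦ adj G x₀ b ⟧) ys + pathSum (λ a _ → ⟦ adj G a z ⟧) x₁ ys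
      ≤ length ys + pathSum (λ a _ → ⟦ S a ⟧) x₁ ys + pathSum (rotationCandidate S x₀ z) x₁ ys
  neighbours-along S x₀ z x₁ ys = begin
    sumMap (λ b → ⟦ adj G x₀ b ⟧) ys + nbrs-z
      ≡⟨ cong (_+ nbrs-z) (pathSum-second (λ b → ⟦ adj G x₀ b ⟧) x₁ ys) ⟨
    pathSum (λ _ b → ⟦ adj G x₀ b ⟧) x₁ ys + nbrs-z
      ≡⟨ pathSum-+ (λ _ b → ⟦ adj G x₀ b ⟧) (λ a _ → ⟦ adj G a z ⟧) x₁ ys ⟨
    pathSum (λ a b → ⟦ adj G x₀ b ⟧ + ⟦ adj G a z ⟧) x₁ ys
      ≤⟨ pathSum-mono (λ a b → ⟦⟧-∧-not (adj G x₀ b) (adj G a z) (S a)) x₁ ys ⟩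
    pathSum (λ a b → 1 + ⟦ S a ⟧ + rotationCandidate S x₀ z a b) x₁ ys
      ≡⟨ pathSum-+ (λ a _ → 1 + ⟦ S a ⟧) (rotationCandidate S x₀ z) x₁ ys ⟩
    pathSum (λ a _ → 1 + ⟦ S a ⟧) x₁ ys + T
      ≡⟨ cong (_+ T) (pathSum-+ (λ _ _ → 1) (λ a _ → ⟦ S a ⟧) x₁ ys) ⟩
    pathSum (λ _ _ → 1) x₁ ys + protected + T
      ≡⟨ cong (λ k → k + protected + T) (trans (pathSum-second (λ _ → 1) x₁ ys) (sumMap-const-1 ys)) ⟩
    length ys + protected + T
      ∎
    where
      open ≤-Reasoning
      nbrs-z = pathSum (λ a _ → ⟦ adj G a z ⟧) x₁ ys
      protected = pathSum (λ a _ → ⟦ S a ⟧) x₁ ys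
      T = pathSum (rotationCandidate S x₀ z) x₁ ys

  rotationCandidate-exists : ∀ S → MinDegreeSum (n + size S) → ∀ x₀ x₁ ys →
    Enumeration (x₀ ∷ x₁ ∷ ys) → adj G (endpoint x₁ ys) x₀ ≡ false →
    1 ≤ pathSum (rotationCandidate S x₀ (endpoint x₁ ys)) x₁ ys
  rotationCandidate-exists S degrees x₀ x₁ ys enum open-end =
    +-cancelˡ-≤ (suc ℓ + size S) 1 T (begin
      suc ℓ + size S + 1             ≡⟨ shuffle₁ ℓ (size S) ⟩
      suc (suc ℓ) + size S           ≡⟨ cong (_+ size S) (enumeration-length enum) ⟩
      n + size S                     ≤⟨ degrees x₀ z ⟩
      degree G x₀ + degree G z       ≤⟨ +-mono-≤ (degree-first x₀ x₁ ys enum) (degree-last x₀ x₁ ys enum open-end) ⟩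
      1 + nbrs-x₀ + nbrs-z           ≤⟨ +-monoʳ-≤ 1 (neighbours-along S x₀ z x₁ ys) ⟩
      1 + (ℓ + protected + T)        ≤⟨ +-monoʳ-≤ 1 (+-monoˡ-≤ T (+-monoʳ-≤ ℓ protected≤size)) ⟩
      1 + (ℓ + size S + T)           ≡⟨ shuffle₂ ℓ (size S) T ⟩
      suc ℓ + size S + T             ∎)
    where
      open ≤-Reasoning
      z = endpoint x₁ ys
      ℓ = length ys
      T = pathSum (rotationCandidate S x₀ z) x₁ ys
      protected = pathSum (λ a _ → ⟦ S a ⟧) x₁ ys
      nbrs-x₀ = sumMap (λ b → ⟦ adj G x₀ b ⟧) ys
      nbrs-z = pathSum (λ a _ → ⟦ adj G a z ⟧) x₁ ys

      protected≤size : protected ≤ size S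
      protected≤size = begin
        protected                               ≤⟨ m≤m+n protected _ ⟩
        protected + ⟦ S z ⟧                     ≡⟨ pathSum-first (λ a → ⟦ S a ⟧) x₁ ys ⟩
        sumMap (λ a → ⟦ S a ⟧) (x₁ ∷ ys)        ≤⟨ m≤n+m _ ⟦ S x₀ ⟧ ⟩
        sumMap (λ a → ⟦ S a ⟧) (x₀ ∷ x₁ ∷ ys)   ≡⟨ sumMap-enumeration enum (λ a → ⟦ S a ⟧) ⟩
        size S                                  ∎

      shuffle₁ : ∀ a b → suc a + b + 1 ≡ suc (suc a) + b
      shuffle₁ = solve-∀
      shuffle₂ : ∀ a b c → 1 + (a + b + c) ≡ suc a + b + c
      shuffle₂ = solve-∀

  pairIndicator-nonEdge : ∀ (u v a b : Fin n) → adj G a b ≡ false → adj G u v ≡ true → pairIndicator u v a b ≡ 0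
  pairIndicator-nonEdge u v a b ab∉G uv∈G = pairIndicator-zero u v a b different
    where
      different : ¬ SamePair u v a b
      different (inj₁ (a≡u , b≡v)) = false≢true (trans (sym ab∉G) (trans (cong₂ (adj G) a≡u b≡v) uv∈G))
      different (inj₂ (a≡v , b≡u)) =
        false≢true (trans (sym ab∉G) (trans (cong₂ (adj G) a≡v b≡u) (trans (Graph.sym G v u) uv∈G)))

  posaRotation : ∀ S x₀ xs A a b B → xs ≡ A ++ a ∷ b ∷ B →
    adj G x₀ b ≡ true → adj G a (endpoint x₀ xs) ≡ true → S a ≡ false → adj G (endpoint x₀ xs) x₀ ≡ false →
    (x₀ ∷ xs ↭ x₀ ∷ b ∷ B ++ a ∷ reverse A)
    × (defects (x₀ ∷ b ∷ B ++ a ∷ reverse A) < defects (x₀ ∷ xs))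
    × Keeps S (x₀ ∷ xs) (x₀ ∷ b ∷ B ++ a ∷ reverse A)
  posaRotation S x₀ _ A a b B refl x₀b∈G az∈G a∉S open-end = prep x₀ rotated , fewer , keeps
    where
      L = x₀ ∷ A ++ a ∷ b ∷ B
      L′ = x₀ ∷ b ∷ B ++ a ∷ reverse A
      z = endpoint x₀ (A ++ a ∷ b ∷ B)

      exchange : ∀ h → SymmetricWeight h → cycleSum h L′ + h a b + h z x₀ ≡ cycleSum h L + h x₀ b + h z a
      exchange h h-sym = subst (λ e → cycleSum h L′ + h a b + h e x₀ ≡ cycleSum h L + h x₀ b + h e a)
                               (sym (endpoint-++ x₀ A (a ∷ b ∷ B))) (cycleSum-posaRotation h h-sym x₀ A a b B)

      fewer : defects L′ < defects L
      fewer = begin-strict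
        defects L′                               <⟨ n<1+n _ ⟩
        suc (defects L′)                         ≤⟨ m≤n+m _ (nonEdge a b) ⟩
        nonEdge a b + suc (defects L′)           ≡⟨ shuffle (defects L′) (nonEdge a b) ⟩
        defects L′ + nonEdge a b + 1             ≡⟨ cong (defects L′ + nonEdge a b +_) (sym za-gap) ⟩
        defects L′ + nonEdge a b + nonEdge z x₀  ≡⟨ exchange nonEdge nonEdge-sym ⟩
        defects L + nonEdge x₀ b + nonEdge z a   ≡⟨ cong₂ (λ p q → defects L + p + q) x₀b-edge za-edge ⟩
        defects L + 0 + 0                        ≡⟨ trans (+-identityʳ _) (+-identityʳ _) ⟩
        defects L                                ∎
        where
          open ≤-Reasoning
          shuffle : ∀ a b → b + suc a ≡ a + b + 1
          shuffle = solve-∀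
          x₀b-edge : nonEdge x₀ b ≡ 0
          x₀b-edge = cong (if_then 0 else 1) x₀b∈G
          za-edge : nonEdge z a ≡ 0
          za-edge = cong (if_then 0 else 1) (trans (Graph.sym G z a) az∈G)
          za-gap : nonEdge z x₀ ≡ 1
          za-gap = cong (if_then 0 else 1) open-end

      keeps : Keeps S L L′
      keeps u v u∈S v∈S uv∈G = begin
        c L                                     ≤⟨ m≤m+n _ _ ⟩
        c L + p x₀ b                            ≤⟨ m≤m+n _ _ ⟩
        c L + p x₀ b + p z a                    ≡⟨ sym (exchange p (pairIndicator-sym u v)) ⟩
        c L′ + p a b + p z x₀                   ≡⟨ cong₂ (λ s t → c L′ + s + t)
                                                         (pairIndicator-outside S u v a b a∉S u∈S v∈S)
                                                         (pairIndicator-nonEdge u v z x₀ open-end uv∈G) ⟩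
        c L′ + 0 + 0                            ≡⟨ trans (+-identityʳ _) (+-identityʳ _) ⟩
        c L′                                    ∎
        where
          open ≤-Reasoning
          p = pairIndicator u v
          c = cycleSum p

      rotated : A ++ a ∷ b ∷ B ↭ b ∷ B ++ a ∷ reverse A
      rotated = begin
        A ++ a ∷ b ∷ B              ↭⟨ ++⁺ʳ (a ∷ b ∷ B) (↭-reverse A) ⟨
        reverse A ++ a ∷ b ∷ B      ↭⟨ shift a (reverse A) (b ∷ B) ⟩
        a ∷ reverse A ++ b ∷ B      ↭⟨ ++-comm (a ∷ reverse A) (b ∷ B) ⟩
        b ∷ B ++ a ∷ reverse A      ∎
        where open PermutationReasoning

  posaRotation-step : ∀ S → MinDegreeSum (n + size S) → 3 ≤ n → ∀ L → Enumeration L → 1 ≤ defects L →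
    ∃ λ L′ → (L ↭ L′) × (defects L′ < defects L) × Keeps S L L′
  posaRotation-step S degrees n≥3 L enum pos with rotateToDefect L pos
  ... | x₀ , [] , _ , reorder , _ =
    ⊥-elim (3≰1 (subst (3 ≤_) (sym (enumeration-length {L = [ x₀ ]} (enumeration-↭ enum reorder))) n≥3))
    where
      3≰1 : ¬ 3 ≤ 1
      3≰1 (s≤s ())
  ... | x₀ , x₁ ∷ ys , same-cycle , reorder , open-end
    with pathSum-positive⇒split (rotationCandidate S x₀ (endpoint x₁ ys)) x₁ ys
           (rotationCandidate-exists S degrees x₀ x₁ ys (enumeration-↭ enum reorder) open-end)
  ... | A , a , b , B , split , candidate with ⟦⟧-∧-not-positive _ _ _ candidate
  ... | x₀b∈G , az∈G , a∉S with posaRotation S x₀ (x₁ ∷ ys) A a b B split x₀b∈G az∈G a∉S open-end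
  ... | rotated , fewer , keeps =
    _ , ↭-trans reorder rotated , subst (_ <_) (same-cycle nonEdge) fewer ,
    λ u v u∈S v∈S uv∈G → subst (_≤ _) (same-cycle (pairIndicator u v)) (keeps u v u∈S v∈S uv∈G)

  posaClosure : ∀ S → MinDegreeSum (n + size S) → 3 ≤ n → ∀ L → Enumeration L →
    ∃ λ L′ → Enumeration L′ × (defects L′ ≡ 0) × Keeps S L L′
  posaClosure S degrees n≥3 L enum = close (defects L) L enum ≤-refl
    where
      close : ∀ fuel L → Enumeration L → defects L ≤ fuel →
              ∃ λ L′ → Enumeration L′ × (defects L′ ≡ 0) × Keeps S L L′
      close fuel L enum bound with defects L in eq
      ... | zero = L , enum , eq , keeps-refl {S} {L}
      close (suc fuel) L enum (s≤s bound) | suc _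
        with posaRotation-step S degrees n≥3 L enum (subst (1 ≤_) (sym eq) (s≤s z≤n))
      ... | L′ , reorder , fewer , keeps
        with close fuel L′ (enumeration-↭ enum reorder) (≤-trans (≤-pred (subst (defects L′ <_) eq fewer)) bound)
      ... | L″ , enum″ , closed , keeps′ = L″ , enum″ , closed , keeps-trans {S} {L} {L′} {L″} keeps keeps′

-- Switching a bowtie

module Switching {n : ℕ} (G : Graph n) where
  open Orderings G

  switch-at-front : ∀ {v₁ v₂ v₃ v₄ v₅} → IsBowtie G v₁ v₂ v₃ v₄ v₅ →
    ∀ M → occurrences v₁ M ≡ 0 → defects (v₁ ∷ M) ≡ 0 →
    Traverses (v₁ ∷ M) v₁ v₂ → Traverses (v₁ ∷ M) v₁ v₃ → Traverses (v₁ ∷ M) v₄ v₅ →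
    ∃ λ L′ → (v₁ ∷ M ↭ L′) × (defects L′ ≡ 0) × Switched v₁ v₂ v₃ v₄ v₅ (v₁ ∷ M) L′
  switch-at-front (v₁≢v₂ , _) [] _ _ t₁₂ _ _ with pairIndicator-positive _ _ _ _ t₁₂
  ... | inj₁ (_ , v₁≡v₂) = ⊥-elim (v₁≢v₂ v₁≡v₂)
  ... | inj₂ (v₁≡v₂ , _) = ⊥-elim (v₁≢v₂ v₁≡v₂)
  switch-at-front {v₁} {v₂} {v₃} {v₄} {v₅}
    (v₁≢v₂ , v₁≢v₃ , v₁≢v₄ , v₁≢v₅ , v₂≢v₃ , _ , _ , _ , _ , _ , _ , _ , v₁v₄ , v₁v₅ , v₂v₃ , _)
    (c ∷ W) absent hamiltonian t₁₂ t₁₃ t₄₅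
    with pathSum-positive⇒split (pairIndicator v₄ v₅) c W inner₄₅
    where
      inner₄₅ : 1 ≤ pathSum (pairIndicator v₄ v₅) c W
      inner₄₅ = subst (1 ≤_) (trans (cong₂ (λ s t → s + pathSum (pairIndicator v₄ v₅) c W + t) (off c) off′)
                                    (+-identityʳ _)) t₄₅
        where
          off : ∀ b → pairIndicator v₄ v₅ v₁ b ≡ 0
          off = pairIndicator-avoid v₁≢v₄ v₁≢v₅
          off′ : pairIndicator v₄ v₅ (endpoint c W) v₁ ≡ 0
          off′ = trans (pairIndicator-sym v₄ v₅ (endpoint c W) v₁) (off (endpoint c W))
  ... | P , a , b , Q , split , ab-positive = L′ , move-↭ v₁ c W P a b Q split , hamiltonian′ , switched
    where
      z = endpoint c W
      L′ = P ++ a ∷ v₁ ∷ b ∷ Q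

      ends : SamePair v₂ v₃ c z
      ends with traverses-neighbour v₁ v₂ c W absent v₁≢v₂ t₁₂
                | traverses-neighbour v₁ v₃ c W absent v₁≢v₃ t₁₃
      ... | inj₁ c≡v₂ | inj₁ c≡v₃ = ⊥-elim (v₂≢v₃ (trans (sym c≡v₂) c≡v₃))
      ... | inj₁ c≡v₂ | inj₂ z≡v₃ = inj₁ (c≡v₂ , z≡v₃)
      ... | inj₂ z≡v₂ | inj₁ c≡v₃ = inj₂ (c≡v₃ , z≡v₂)
      ... | inj₂ z≡v₂ | inj₂ z≡v₃ = ⊥-elim (v₂≢v₃ (trans (sym z≡v₂) z≡v₃))

      switched : Switched v₁ v₂ v₃ v₄ v₅ (v₁ ∷ c ∷ W) L′
      switched = switched-move v₁ c W P a b Q split ends (pairIndicator-positive v₄ v₅ a b ab-positive)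

      added-edges : nonEdge v₁ v₄ + nonEdge v₁ v₅ + nonEdge v₂ v₃ ≡ 0
      added-edges rewrite v₁v₄ | v₁v₅ | v₂v₃ = refl

      hamiltonian′ : defects L′ ≡ 0
      hamiltonian′ = m+n≡0⇒m≡0 (defects L′) (trans (switched nonEdge nonEdge-sym) (cong₂ _+_ hamiltonian added-edges))

  switch-step : ∀ {v₁ v₂ v₃ v₄ v₅} → IsBowtie G v₁ v₂ v₃ v₄ v₅ →
    ∀ L → Enumeration L → defects L ≡ 0 →
    Traverses L v₁ v₂ → Traverses L v₁ v₃ → Traverses L v₄ v₅ →
    ∃ λ L′ → (L ↭ L′) × (defects L′ ≡ 0) × Switched v₁ v₂ v₃ v₄ v₅ L L′
  switch-step {v₁} {v₂} {v₃} {v₄} {v₅} bowtie L enum hamiltonian t₁₂ t₁₃ t₄₅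
    with occurrences-split v₁ L (≤-reflexive (sym (occurs-once enum v₁)))
  ... | P , Q , refl =
    transport (switch-at-front bowtie (Q ++ P) absent (trans (rotated nonEdge) hamiltonian)
                                (moved t₁₂) (moved t₁₃) (moved t₄₅))
    where
      rotated : ∀ h → cycleSum h (v₁ ∷ Q ++ P) ≡ cycleSum h (P ++ v₁ ∷ Q)
      rotated h = sym (cycleSum-++-comm h P (v₁ ∷ Q))

      moved : ∀ {u v} → Traverses (P ++ v₁ ∷ Q) u v → Traverses (v₁ ∷ Q ++ P) u v
      moved = subst (1 ≤_) (sym (rotated _))

      rotation : P ++ v₁ ∷ Q ↭ v₁ ∷ Q ++ P
      rotation = ++-comm P (v₁ ∷ Q)

      absent : occurrences v₁ (Q ++ P) ≡ 0
      absent = suc-injective (begin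
        suc (occurrences v₁ (Q ++ P))               ≡⟨ cong (λ e → ⟦ e ⟧ + occurrences v₁ (Q ++ P)) (≡ᵇ-refl v₁) ⟨
        occurrences v₁ (v₁ ∷ Q ++ P)                ≡⟨ sumMap-↭ _ rotation ⟨
        occurrences v₁ (P ++ v₁ ∷ Q)                ≡⟨ occurs-once enum v₁ ⟩
        1                                           ∎)
        where open ≡-Reasoning

      transport :
        (∃ λ L′ → (v₁ ∷ Q ++ P ↭ L′) × (defects L′ ≡ 0) × Switched v₁ v₂ v₃ v₄ v₅ (v₁ ∷ Q ++ P) L′) →
        ∃ λ L′ → (P ++ v₁ ∷ Q ↭ L′) × (defects L′ ≡ 0) × Switched v₁ v₂ v₃ v₄ v₅ (P ++ v₁ ∷ Q) L′
      transport (L′ , reorder , hamiltonian′ , switched) =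
        L′ , ↭-trans rotation reorder , hamiltonian′ ,
        λ h h-sym → trans (switched h h-sym) (cong (_+ (h v₁ v₄ + h v₁ v₅ + h v₂ v₃)) (rotated h))

next-inject₁ : ∀ {k} (j : Fin k) → next {suc k} (inject₁ j) ≡ fsuc j
next-inject₁ {k} j with toℕ (inject₁ j) <? k
... | yes p = toℕ-injective (trans (toℕ-fromℕ< (s≤s p)) (cong suc (toℕ-inject₁ j)))
... | no ¬p = ⊥-elim (¬p (subst (_< k) (sym (toℕ-inject₁ j)) (toℕ<n j)))

next-fromℕ : ∀ k → next {suc k} (fromℕ k) ≡ fzero
next-fromℕ k with toℕ (fromℕ k) <? k
... | yes p = ⊥-elim (<-irrefl (toℕ-fromℕ k) p)
... | no _  = refl

module _ {A : Set} (h : A → A → ℕ) where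

  pathSum-tabulate : ∀ {k} (g : Fin (suc k) → A) →
                     sumFin (λ j → h (g (inject₁ j)) (g (fsuc j))) ≡ pathSum h (g fzero) (tabulate (g ∘ fsuc))
  pathSum-tabulate {zero}  g = refl
  pathSum-tabulate {suc k} g =
    trans (sumFin-suc (λ j → h (g (inject₁ j)) (g (fsuc j))))
          (cong (h (g fzero) (g (fsuc fzero)) +_) (pathSum-tabulate (g ∘ fsuc)))

  endpoint-tabulate : ∀ {k} (g : Fin (suc k) → A) → endpoint (g fzero) (tabulate (g ∘ fsuc)) ≡ g (fromℕ k)
  endpoint-tabulate {zero}  g = refl
  endpoint-tabulate {suc k} g = endpoint-tabulate (g ∘ fsuc)

  cycleSum-tabulate : ∀ {k} (g : Fin (suc k) → A) → sumFin (λ i → h (g i) (g (next i))) ≡ cycleSum h (tabulate g)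
  cycleSum-tabulate {k} g = trans (sumFin-snoc (λ i → h (g i) (g (next i))))
    (cong₂ _+_ (trans (sumFin-cong (λ j → cong (h (g (inject₁ j)) ∘ g) (next-inject₁ j))) (pathSum-tabulate g))
               (cong₂ h (sym (endpoint-tabulate g)) (cong g (next-fromℕ k))))

tabulate-lookup-cast : ∀ {A : Set} (L : List A) {m} (eq : length L ≡ m) → tabulate (lookup L ∘ cast (sym eq)) ≡ L
tabulate-lookup-cast L refl = trans (tabulate-cong (λ i → cong (lookup L) (cast-is-id refl i))) (tabulate-lookup L)

hamiltonCycle : ∀ {n} (G : Graph n) → 3 ≤ n → ∀ L → Enumeration L → Orderings.defects G L ≡ 0 →
  Σ (HamiltonCycle G) λ H → ∀ h → sumFin (λ i → h (σ H ⟨$⟩ʳ i) (σ H ⟨$⟩ʳ next i)) ≡ cycleSum h L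
hamiltonCycle {suc k} G n≥3 L enum hamiltonian = H , same-cycle
  where
    open Orderings G

    length≡ : length L ≡ suc k
    length≡ = enumeration-length enum

    position : Fin (suc k) → Fin (suc k)
    position = lookup L ∘ cast (sym length≡)

    index : ∀ v → Σ (Fin (length L)) λ i → lookup L i ≡ v
    index v = lookup-occurrence v L (≤-reflexive (sym (occurs-once enum v)))

    position⁻¹ : Fin (suc k) → Fin (suc k)
    position⁻¹ v = cast length≡ (proj₁ (index v))

    inverseˡ : ∀ v → position (position⁻¹ v) ≡ v
    inverseˡ v = trans (cong (lookup L) (cast-involutive (sym length≡) length≡ _)) (proj₂ (index v))

    inverseʳ : ∀ i → position⁻¹ (position i) ≡ i
    inverseʳ i = trans (cong (cast length≡) (lookup-injective L (λ v → ≤-reflexive (occurs-once enum v)) _ _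
                                                (proj₂ (index (position i)))))
                       (cast-involutive length≡ (sym length≡) i)

    same-cycle : ∀ h → sumFin (λ i → h (position i) (position (next i))) ≡ cycleSum h L
    same-cycle h = trans (cycleSum-tabulate h position) (cong (cycleSum h) (tabulate-lookup-cast L length≡))

    consecutive-adjacent : ∀ i → adj G (position i) (position (next i)) ≡ true
    consecutive-adjacent i =
      nonEdge-zero (sumMap≡0⇒≡0 (λ i → nonEdge (position i) (position (next i))) (allFin (suc k))
                                (trans (same-cycle nonEdge) hamiltonian) (∈-allFin i))

    H : HamiltonCycle G
    H = record { three≤n = n≥3 ; σ = mk↔ₛ′ position position⁻¹ inverseˡ inverseʳ ; edges = consecutive-adjacent }

-- Bowtie packings

record Bowtie (n : ℕ) : Set where
  constructor bowtie
  field v₁ v₂ v₃ v₄ v₅ : Fin n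

module Packings {n : ℕ} (G : Graph n) where
  open Orderings G

  IsBowtieᵇ : Bowtie n → Set
  IsBowtieᵇ (bowtie v₁ v₂ v₃ v₄ v₅) = IsBowtie G v₁ v₂ v₃ v₄ v₅

  Outside : (Fin n → Bool) → Bowtie n → Set
  Outside S (bowtie v₁ v₂ v₃ v₄ v₅) =
    (S v₁ ≡ false) × (S v₂ ≡ false) × (S v₃ ≡ false) × (S v₄ ≡ false) × (S v₅ ≡ false)

  -- Each bowtie is laid out as the path v₂ v₁ v₃ v₄ v₅, which traverses the edges v₁v₂, v₁v₃
  -- and v₄v₅ that its switch removes.
  blocks : List (Bowtie n) → List (Fin n)
  blocks []                             = []
  blocks (bowtie v₁ v₂ v₃ v₄ v₅ ∷ Bs) = v₂ ∷ v₁ ∷ v₃ ∷ v₄ ∷ v₅ ∷ blocks Bs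

  covered : List (Bowtie n) → Fin n → Bool
  covered Bs v = v ∈ᵇ blocks Bs

  Disjoint : List (Bowtie n) → Set
  Disjoint []       = ⊤
  Disjoint (B ∷ Bs) = IsBowtieᵇ B × Outside (covered Bs) B × Disjoint Bs

  TraversesBowtie : List (Fin n) → Bowtie n → Set
  TraversesBowtie L (bowtie v₁ v₂ v₃ v₄ v₅) = Traverses L v₁ v₂ × Traverses L v₁ v₃ × Traverses L v₄ v₅

  initialEnumeration : List (Bowtie n) → List (Fin n)
  initialEnumeration Bs = blocks Bs ++ filterᵇ (not ∘ covered Bs) (allFin n)

  length-blocks : ∀ Bs → length (blocks Bs) ≡ 5 * length Bs
  length-blocks []       = refl
  length-blocks (bowtie v₁ v₂ v₃ v₄ v₅ ∷ Bs) = trans (cong (5 +_) (length-blocks Bs)) (sym (*-suc 5 (length Bs)))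

  size-covered : ∀ Bs → size (covered Bs) ≤ 5 * length Bs
  size-covered Bs = subst (size (covered Bs) ≤_) (length-blocks Bs) (size-∈ᵇ (blocks Bs))

  disjoint⇒unique : ∀ Bs → Disjoint Bs → Unique (blocks Bs)
  disjoint⇒unique [] _ = []
  disjoint⇒unique (bowtie v₁ v₂ v₃ v₄ v₅ ∷ Bs)
    ((v₁≢v₂ , v₁≢v₃ , v₁≢v₄ , v₁≢v₅ , v₂≢v₃ , v₂≢v₄ , v₂≢v₅ , v₃≢v₄ , v₃≢v₅ , v₄≢v₅ , _) ,
     (v₁∉ , v₂∉ , v₃∉ , v₄∉ , v₅∉) , disjoint) =
    (≢-sym v₁≢v₂ ∷ v₂≢v₃ ∷ v₂≢v₄ ∷ v₂≢v₅ ∷ ∉ᵇ⇒All≢ (blocks Bs) v₂∉) ∷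
    (v₁≢v₃ ∷ v₁≢v₄ ∷ v₁≢v₅ ∷ ∉ᵇ⇒All≢ (blocks Bs) v₁∉) ∷
    (v₃≢v₄ ∷ v₃≢v₅ ∷ ∉ᵇ⇒All≢ (blocks Bs) v₃∉) ∷
    (v₄≢v₅ ∷ ∉ᵇ⇒All≢ (blocks Bs) v₄∉) ∷
    ∉ᵇ⇒All≢ (blocks Bs) v₅∉ ∷
    disjoint⇒unique Bs disjoint

  initialEnumeration-enumerates : ∀ Bs → Disjoint Bs → Enumeration (initialEnumeration Bs)
  initialEnumeration-enumerates Bs disjoint = enumeration λ v → begin
    occurrences v (blocks Bs ++ filterᵇ (not ∘ covered Bs) (allFin n))
      ≡⟨ sumMap-++ (λ a → ⟦ a ≡ᵇ v ⟧) (blocks Bs) _ ⟩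
    occurrences v (blocks Bs) + occurrences v (filterᵇ (not ∘ covered Bs) (allFin n))
      ≡⟨ cong₂ _+_ (occurrences-unique (disjoint⇒unique Bs disjoint) v) (occurrences-filterᵇ-allFin _ v) ⟩
    ⟦ covered Bs v ⟧ + ⟦ not (covered Bs v) ⟧
      ≡⟨ complementary (covered Bs v) ⟩
    1 ∎
    where
      open ≡-Reasoning
      complementary : ∀ b → ⟦ b ⟧ + ⟦ not b ⟧ ≡ 1
      complementary true  = refl
      complementary false = refl

  blocks-traversed : ∀ Bs Pre Post → All (TraversesBowtie (Pre ++ blocks Bs ++ Post)) Bs
  blocks-traversed []                             Pre Post = []
  blocks-traversed (bowtie v₁ v₂ v₃ v₄ v₅ ∷ Bs) Pre Post =
    (at (pairIndicator-backward v₁ v₂) [] (v₃ ∷ v₄ ∷ v₅ ∷ rest) ,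
     at (pairIndicator-forward v₁ v₃) [ v₂ ] (v₄ ∷ v₅ ∷ rest) ,
     at (pairIndicator-forward v₄ v₅) (v₂ ∷ v₁ ∷ [ v₃ ]) rest) ∷
    subst (λ L → All (TraversesBowtie L) Bs) (++-assoc Pre (v₂ ∷ v₁ ∷ v₃ ∷ v₄ ∷ [ v₅ ]) rest)
          (blocks-traversed Bs (Pre ++ v₂ ∷ v₁ ∷ v₃ ∷ v₄ ∷ [ v₅ ]) Post)
    where
      rest = blocks Bs ++ Post
      at : ∀ {u v a b} → pairIndicator u v a b ≡ 1 → ∀ X Q → Traverses (Pre ++ X ++ a ∷ b ∷ Q) u v
      at {u} {v} {a} {b} one X Q =
        subst (λ L → 1 ≤ cycleSum (pairIndicator u v) L) (++-assoc Pre X (a ∷ b ∷ Q))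
              (subst (_≤ cycleSum (pairIndicator u v) ((Pre ++ X) ++ a ∷ b ∷ Q)) one
                     (cycleSum-segment (pairIndicator u v) (Pre ++ X) a b Q))

  covered-∷ : ∀ B Bs v → covered Bs v ≡ true → covered (B ∷ Bs) v ≡ true
  covered-∷ (bowtie v₁ v₂ v₃ v₄ v₅) Bs v v∈Bs =
    ∈⇒∈ᵇ {xs = blocks (bowtie v₁ v₂ v₃ v₄ v₅ ∷ Bs)}
         (there (there (there (there (there (∈ᵇ⇒∈ (blocks Bs) v∈Bs))))))

  traversal-kept : ∀ {S L L′} Bs → (∀ v → covered Bs v ≡ true → S v ≡ true) → Disjoint Bs → Keeps S L L′ →
                   All (TraversesBowtie L) Bs → All (TraversesBowtie L′) Bs
  traversal-kept                      []                             _   _ _     []  = []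
  traversal-kept {S} {L} {L′} (B@(bowtie v₁ v₂ v₃ v₄ v₅) ∷ Bs) ⊆S
    ((_ , _ , _ , _ , _ , _ , _ , _ , _ , _ , v₁v₂ , v₁v₃ , _ , _ , _ , v₄v₅) , _ , disjoint) keeps
    ((t₁₂ , t₁₃ , t₄₅) ∷ ts) =
    (≤-trans t₁₂ (keeps v₁ v₂ (in-S (there (here refl))) (in-S (here refl)) v₁v₂) ,
     ≤-trans t₁₃ (keeps v₁ v₃ (in-S (there (here refl))) (in-S (there (there (here refl)))) v₁v₃) ,
     ≤-trans t₄₅ (keeps v₄ v₅ (in-S (there (there (there (here refl)))))
                             (in-S (there (there (there (there (here refl)))))) v₄v₅)) ∷
    traversal-kept {S} {L} {L′} Bs (λ v → ⊆S v ∘ covered-∷ B Bs v) disjoint keeps ts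
    where
      in-S : ∀ {v} → v ∈ blocks (B ∷ Bs) → S v ≡ true
      in-S {v} v∈B∷Bs = ⊆S v (∈⇒∈ᵇ v∈B∷Bs)

  switch-keeps : ∀ {S L L′} v₁ v₂ v₃ v₄ v₅ → Outside S (bowtie v₁ v₂ v₃ v₄ v₅) →
                 Switched v₁ v₂ v₃ v₄ v₅ L L′ → Keeps S L L′
  switch-keeps {S} {L} {L′} v₁ v₂ v₃ v₄ v₅ (v₁∉S , v₂∉S , _ , v₄∉S , _) switched u v u∈S v∈S _ =
    ≤-reflexive (begin
      c L                                     ≡⟨ sym (+-identityʳ _) ⟩
      c L + 0                                 ≡⟨ cong (c L +_) (sym added) ⟩
      c L + (p v₁ v₄ + p v₁ v₅ + p v₂ v₃)     ≡⟨ sym (switched p (pairIndicator-sym u v)) ⟩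
      c L′ + (p v₁ v₂ + p v₁ v₃ + p v₄ v₅)    ≡⟨ cong (c L′ +_) removed ⟩
      c L′ + 0                                ≡⟨ +-identityʳ _ ⟩
      c L′                                    ∎)
    where
      open ≡-Reasoning
      p = pairIndicator u v
      c = cycleSum p
      outside : ∀ {a} b → S a ≡ false → p a b ≡ 0
      outside {a} b a∉S = pairIndicator-outside S u v a b a∉S u∈S v∈S
      removed : p v₁ v₂ + p v₁ v₃ + p v₄ v₅ ≡ 0
      removed rewrite outside v₂ v₁∉S | outside v₃ v₁∉S | outside v₅ v₄∉S = refl
      added : p v₁ v₄ + p v₁ v₅ + p v₂ v₃ ≡ 0
      added rewrite outside v₄ v₁∉S | outside v₅ v₁∉S | outside v₃ v₂∉S = refl

-- Improving bowties of one colour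

biased-counts-close : ∀ r n c₁ c₂ m → ∣ r * c₁ - n ∣ < r * m → ∣ r * c₂ - n ∣ < r * m →
                      ¬ (c₁ + 2 * m ≤ c₂)
biased-counts-close r n c₁ c₂ m close₁ close₂ far = <-irrefl refl (begin-strict
  r * c₁ + r * m + r * m           ≡⟨ distribute r c₁ m ⟩
  r * (c₁ + 2 * m)                 ≤⟨ *-monoʳ-≤ r far ⟩
  r * c₂                           ≤⟨ m≤n+∣m-n∣ (r * c₂) n ⟩
  n + ∣ r * c₂ - n ∣               <⟨ +-monoʳ-< n close₂ ⟩
  n + r * m                        ≤⟨ +-monoˡ-≤ (r * m) (m≤n+∣n-m∣ n (r * c₁)) ⟩
  r * c₁ + ∣ r * c₁ - n ∣ + r * m  <⟨ +-monoˡ-< (r * m) (+-monoʳ-< (r * c₁) close₁) ⟩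
  r * c₁ + r * m + r * m           ∎)
  where
    open ≤-Reasoning
    distribute : ∀ r c m → r * c + r * m + r * m ≡ r * (c + 2 * m)
    distribute = solve-∀

module ColourClass {n r : ℕ} {G : Graph n} (χ : EdgeColoring G r) (k : Fin r) where
  open Orderings G
  open Switching G
  open Packings G

  colourWeight : Fin n → Fin n → ℕ
  colourWeight a b = ⟦ does (col χ a b ≟ k) ⟧

  colourWeight-sym : SymmetricWeight colourWeight
  colourWeight-sym a b = cong (λ c → ⟦ does (c ≟ k) ⟧) (col-sym χ a b)

  Improving : Bowtie n → Set
  Improving (bowtie v₁ v₂ v₃ v₄ v₅) =
    colourWeight v₁ v₂ + colourWeight v₁ v₃ + colourWeight v₄ v₅
      < colourWeight v₁ v₄ + colourWeight v₁ v₅ + colourWeight v₂ v₃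

  switch-all : ∀ Bs → Disjoint Bs → All Improving Bs → ∀ L → Enumeration L → defects L ≡ 0 →
    All (TraversesBowtie L) Bs →
    ∃ λ L′ → Enumeration L′ × (defects L′ ≡ 0) × (cycleSum colourWeight L + length Bs ≤ cycleSum colourWeight L′)
  switch-all [] _ _ L enum hamiltonian _ = L , enum , hamiltonian , ≤-reflexive (+-identityʳ _)
  switch-all (bowtie v₁ v₂ v₃ v₄ v₅ ∷ Bs) (isBowtie , outside , disjoint) (improving ∷ improvings)
             L enum hamiltonian ((t₁₂ , t₁₃ , t₄₅) ∷ traversed)
    with switch-step isBowtie L enum hamiltonian t₁₂ t₁₃ t₄₅
  ... | L′ , reorder , hamiltonian′ , switched
    with switch-all Bs disjoint improvings L′ (enumeration-↭ enum reorder) hamiltonian′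
           (traversal-kept {covered Bs} {L} {L′} Bs (λ _ → id) disjoint
                           (switch-keeps {covered Bs} {L} {L′} v₁ v₂ v₃ v₄ v₅ outside switched) traversed)
  ... | L″ , enum″ , hamiltonian″ , gained = L″ , enum″ , hamiltonian″ , (begin
    c L + suc (length Bs)      ≡⟨ +-suc (c L) (length Bs) ⟩
    suc (c L) + length Bs      ≤⟨ +-monoˡ-≤ (length Bs) one-more ⟩
    c L′ + length Bs           ≤⟨ gained ⟩
    c L″                       ∎)
    where
      open ≤-Reasoning
      c = cycleSum colourWeight
      one-more : c L < c L′
      one-more = +-cancelʳ-< _ (c L) (c L′) (begin-strict
        c L + (colourWeight v₁ v₂ + colourWeight v₁ v₃ + colourWeight v₄ v₅)
          <⟨ +-monoʳ-< (c L) improving ⟩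
        c L + (colourWeight v₁ v₄ + colourWeight v₁ v₅ + colourWeight v₂ v₃)
          ≡⟨ sym (switched colourWeight colourWeight-sym) ⟩
        c L′ + (colourWeight v₁ v₂ + colourWeight v₁ v₃ + colourWeight v₄ v₅)
          ∎)

  no-large-improving-packing : 3 ≤ n → ∀ m Bs → Disjoint Bs → All Improving Bs →
    MinDegreeSum (n + size (covered Bs)) → 2 * m ≤ length Bs → ¬ (∀ H → ColorBiasLt χ H m)
  no-large-improving-packing n≥3 m Bs disjoint improving degrees large unbiased
    with posaClosure (covered Bs) degrees n≥3 (initialEnumeration Bs) (initialEnumeration-enumerates Bs disjoint)
  ... | L₁ , enum₁ , hamiltonian₁ , keeps
    with switch-all Bs disjoint improving L₁ enum₁ hamiltonian₁
           (traversal-kept {covered Bs} {initialEnumeration Bs} {L₁} Bs (λ _ → id) disjoint keeps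
                           (blocks-traversed Bs [] _))
  ... | L₂ , enum₂ , hamiltonian₂ , gained
    with hamiltonCycle G n≥3 L₁ enum₁ hamiltonian₁ | hamiltonCycle G n≥3 L₂ enum₂ hamiltonian₂
  ... | H₁ , same₁ | H₂ , same₂ =
    biased-counts-close r n (colorCount χ H₁ k) (colorCount χ H₂ k) m (unbiased H₁ k) (unbiased H₂ k)
      (subst₂ (λ c₁ c₂ → c₁ + 2 * m ≤ c₂) (sym (same₁ colourWeight)) (sym (same₂ colourWeight))
              (≤-trans (+-monoʳ-≤ (cycleSum colourWeight L₁) large) gained))

  𝟙≡colourWeight : ∀ u v → 𝟙 χ k u v ≡ ℤ.+ colourWeight u v
  𝟙≡colourWeight u v with does (col χ u v ≟ k)
  ... | true  = refl
  ... | false = refl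

  f≡difference : ∀ v₁ v₂ v₃ v₄ v₅ → f χ v₁ v₂ v₃ v₄ v₅ k ≡
    ℤ.+ (colourWeight v₁ v₂ + colourWeight v₁ v₃ + colourWeight v₄ v₅)
      ℤ.- ℤ.+ (colourWeight v₁ v₄ + colourWeight v₁ v₅ + colourWeight v₂ v₃)
  f≡difference v₁ v₂ v₃ v₄ v₅
    rewrite 𝟙≡colourWeight v₁ v₂ | 𝟙≡colourWeight v₁ v₃ | 𝟙≡colourWeight v₄ v₅
          | 𝟙≡colourWeight v₁ v₄ | 𝟙≡colourWeight v₁ v₅ | 𝟙≡colourWeight v₂ v₃
    = trans (regroup (ℤ.+ w₁₂) (ℤ.+ w₁₃) (ℤ.+ w₄₅) (ℤ.+ w₁₄) (ℤ.+ w₁₅) (ℤ.+ w₂₃))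
            (sym (cong₂ ℤ._-_ (pos-+₃ w₁₂ w₁₃ w₄₅) (pos-+₃ w₁₄ w₁₅ w₂₃)))
    where
      w₁₂ = colourWeight v₁ v₂
      w₁₃ = colourWeight v₁ v₃
      w₄₅ = colourWeight v₄ v₅
      w₁₄ = colourWeight v₁ v₄
      w₁₅ = colourWeight v₁ v₅
      w₂₃ = colourWeight v₂ v₃
      regroup : ∀ (a b c d e g : ℤ) →
                ((((a ℤ.+ b) ℤ.+ c) ℤ.- d) ℤ.- e) ℤ.- g ≡ (a ℤ.+ b ℤ.+ c) ℤ.- (d ℤ.+ e ℤ.+ g)
      regroup = ℤ-Solver.solve-∀
      pos-+₃ : ∀ a b c → ℤ.+ (a + b + c) ≡ ℤ.+ a ℤ.+ ℤ.+ b ℤ.+ ℤ.+ c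
      pos-+₃ a b c = trans (pos-+ (a + b) c) (cong (ℤ._+ ℤ.+ c) (pos-+ a b))

  BadOutside : (Fin n → Bool) → Set
  BadOutside S = ∃ λ v₁ → ∃ λ v₂ → ∃ λ v₃ → ∃ λ v₄ → ∃ λ v₅ →
    Outside S (bowtie v₁ v₂ v₃ v₄ v₅) × IsBowtie G v₁ v₂ v₃ v₄ v₅ × (f χ v₁ v₂ v₃ v₄ v₅ k ≢ ℤ.+ 0)

  badOutside? : ∀ S → Dec (BadOutside S)
  badOutside? S = any? λ v₁ → any? λ v₂ → any? λ v₃ → any? λ v₄ → any? λ v₅ →
    ((S v₁ ≟ᵇ false) ×-dec (S v₂ ≟ᵇ false) ×-dec (S v₃ ≟ᵇ false) ×-dec
     (S v₄ ≟ᵇ false) ×-dec (S v₅ ≟ᵇ false)) ×-dec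
    (¬? (v₁ ≟ v₂) ×-dec ¬? (v₁ ≟ v₃) ×-dec ¬? (v₁ ≟ v₄) ×-dec ¬? (v₁ ≟ v₅) ×-dec
     ¬? (v₂ ≟ v₃) ×-dec ¬? (v₂ ≟ v₄) ×-dec ¬? (v₂ ≟ v₅) ×-dec ¬? (v₃ ≟ v₄) ×-dec
     ¬? (v₃ ≟ v₅) ×-dec ¬? (v₄ ≟ v₅) ×-dec
     (adj G v₁ v₂ ≟ᵇ true) ×-dec (adj G v₁ v₃ ≟ᵇ true) ×-dec (adj G v₁ v₄ ≟ᵇ true) ×-dec
     (adj G v₁ v₅ ≟ᵇ true) ×-dec (adj G v₂ v₃ ≟ᵇ true) ×-dec (adj G v₄ v₅ ≟ᵇ true)) ×-dec
    ¬? (f χ v₁ v₂ v₃ v₄ v₅ k ℤ.≟ ℤ.+ 0)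

  orient : ∀ {S} → BadOutside S → ∃ λ B → IsBowtieᵇ B × Outside S B × Improving B
  orient (v₁ , v₂ , v₃ , v₄ , v₅ , outside@(o₁ , o₂ , o₃ , o₄ , o₅) ,
          isBowtie@(n₁₂ , n₁₃ , n₁₄ , n₁₅ , n₂₃ , n₂₄ , n₂₅ , n₃₄ , n₃₅ , n₄₅ ,
                    a₁₂ , a₁₃ , a₁₄ , a₁₅ , a₂₃ , a₄₅) , bad)
    with <-cmp (colourWeight v₁ v₂ + colourWeight v₁ v₃ + colourWeight v₄ v₅)
               (colourWeight v₁ v₄ + colourWeight v₁ v₅ + colourWeight v₂ v₃)
  ... | tri< less _ _ = bowtie v₁ v₂ v₃ v₄ v₅ , isBowtie , outside , less
  ... | tri≈ _ equal _ = ⊥-elim (bad (begin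
    f χ v₁ v₂ v₃ v₄ v₅ k  ≡⟨ f≡difference v₁ v₂ v₃ v₄ v₅ ⟩
    ℤ.+ gain ℤ.- ℤ.+ loss  ≡⟨ cong (λ x → ℤ.+ x ℤ.- ℤ.+ loss) equal ⟩
    ℤ.+ loss ℤ.- ℤ.+ loss  ≡⟨ +-inverseʳ (ℤ.+ loss) ⟩
    ℤ.+ 0                  ∎))
    where
      open ≡-Reasoning
      gain = colourWeight v₁ v₂ + colourWeight v₁ v₃ + colourWeight v₄ v₅
      loss = colourWeight v₁ v₄ + colourWeight v₁ v₅ + colourWeight v₂ v₃
  ... | tri> _ _ greater =
    bowtie v₁ v₄ v₅ v₂ v₃ ,
    (n₁₄ , n₁₅ , n₁₂ , n₁₃ , n₄₅ , ≢-sym n₂₄ , ≢-sym n₃₄ , ≢-sym n₂₅ , ≢-sym n₃₅ , n₂₃ ,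
     a₁₄ , a₁₅ , a₁₂ , a₁₃ , a₄₅ , a₂₃) ,
    (o₁ , o₄ , o₅ , o₂ , o₃) , greater

  greedy : ∀ fuel Bs → Disjoint Bs → All Improving Bs →
    (∃ λ Bs′ → (length Bs′ ≤ length Bs + fuel) × ¬ BadOutside (covered Bs′)) ⊎
    (∃ λ Bs′ → Disjoint Bs′ × All Improving Bs′ × (length Bs′ ≡ length Bs + fuel))
  greedy zero Bs disjoint improving = inj₂ (Bs , disjoint , improving , sym (+-identityʳ _))
  greedy (suc fuel) Bs disjoint improving with badOutside? (covered Bs)
  ... | no saturated = inj₁ (Bs , m≤m+n _ _ , saturated)
  ... | yes bad with orient bad
  ...   | B , isBowtie , outside , improving-B with greedy fuel (B ∷ Bs) (isBowtie , outside , disjoint) (improving-B ∷ improving)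
  ...     | inj₁ (Bs′ , short , saturated) = inj₁ (Bs′ , subst (length Bs′ ≤_) (sym (+-suc _ fuel)) short , saturated)
  ...     | inj₂ (Bs′ , disjoint′ , improving′ , exact) =
    inj₂ (Bs′ , disjoint′ , improving′ , trans exact (sym (+-suc _ fuel)))

  saturatedPacking : 3 ≤ n → ∀ m → (∀ Bs → length Bs ≤ 2 * m → MinDegreeSum (n + size (covered Bs))) →
    (∀ H → ColorBiasLt χ H m) → ∃ λ Bs → (length Bs ≤ 2 * m) × ¬ BadOutside (covered Bs)
  saturatedPacking n≥3 m degrees unbiased with greedy (2 * m) [] tt []
  ... | inj₁ (Bs , short , saturated) = Bs , short , saturated
  ... | inj₂ (Bs , disjoint , improving , exact) =
    ⊥-elim (no-large-improving-packing n≥3 m Bs disjoint improving (degrees Bs (≤-reflexive exact))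
                                       (≤-reflexive (sym exact)) unbiased)

-- The vertices to delete

minDegree≤degree : ∀ {n} (G : Graph n) v → minDegree G ≤ degree G v
minDegree≤degree {n} G v = foldr-⊓≤ (map (degree G) (allFin n)) (∈-map⁺ (degree G) (∈-allFin v))
  where
    foldr-⊓≤ : ∀ xs {x} → x ∈ xs → foldr _⊓_ n xs ≤ x
    foldr-⊓≤ (y ∷ ys) (here refl)  = m⊓n≤m y _
    foldr-⊓≤ (y ∷ ys) (there x∈ys) = ≤-trans (m⊓n≤n y _) (foldr-⊓≤ ys x∈ys)

∣tabulate∣ : ∀ {n} (p : Fin n → Bool) → ∣ Vec.tabulate p ∣ ≡ size p
∣tabulate∣ {zero}  p = refl
∣tabulate∣ {suc n} p = trans (step (p fzero) (∣tabulate∣ (p ∘ fsuc))) (sym (sumFin-suc (λ v → ⟦ p v ⟧)))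
  where
    step : ∀ b {x y} → x ≡ y → (if does (b ≟ᵇ true) then suc else id) x ≡ ⟦ b ⟧ + y
    step true  refl = refl
    step false refl = refl

∉tabulate : ∀ {n} (p : Fin n → Bool) v → v ∉ Vec.tabulate p → p v ≡ false
∉tabulate p v v∉ with p v in pv
... | false = refl
... | true  = ⊥-elim (v∉ (lookup⇒[]= v (Vec.tabulate p) (trans (lookup∘tabulate p v) pv)))

module _ {A : Set} (g : A → Bool) where

  any-false : ∀ xs → any g xs ≡ false → ∀ {x} → x ∈ xs → g x ≡ false
  any-false (y ∷ ys) none (here refl)  = ∨-false-left none
    where
      ∨-false-left : ∀ {b c} → b ∨ c ≡ false → b ≡ false
      ∨-false-left {false} _ = refl
  any-false (y ∷ ys) none (there x∈ys) = any-false ys (∨-false-right (g y) none) x∈ys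
    where
      ∨-false-right : ∀ b {c} → b ∨ c ≡ false → c ≡ false
      ∨-false-right false c≡false = c≡false

  ⟦any⟧≤ : ∀ xs → ⟦ any g xs ⟧ ≤ sumMap (λ x → ⟦ g x ⟧) xs
  ⟦any⟧≤ []       = z≤n
  ⟦any⟧≤ (x ∷ xs) = ≤-trans (⟦⟧-∨-≤ (g x) _) (+-monoʳ-≤ ⟦ g x ⟧ (⟦any⟧≤ xs))

module _ {n : ℕ} (G : Graph n) where
  open Orderings G
  open Packings G

  room-for-packings : ∀ r m → 1 ≤ r → 2 * minDegree G ≡ n + 12 * (r * r * m) →
    ∀ Bs → length Bs ≤ 2 * m → MinDegreeSum (n + size (covered Bs))
  room-for-packings r m r≥1 minDegree≡ Bs short u v = begin
    n + size (covered Bs)          ≤⟨ +-monoʳ-≤ n (≤-trans (size-covered Bs) (*-monoʳ-≤ 5 short)) ⟩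
    n + 5 * (2 * m)                ≤⟨ +-monoʳ-≤ n ten≤twelve ⟩
    n + 12 * (r * r * m)           ≡⟨ sym minDegree≡ ⟩
    2 * minDegree G                ≡⟨ cong (minDegree G +_) (+-identityʳ _) ⟩
    minDegree G + minDegree G      ≤⟨ +-mono-≤ (minDegree≤degree G u) (minDegree≤degree G v) ⟩
    degree G u + degree G v        ∎
    where
      open ≤-Reasoning
      ten≤twelve : 5 * (2 * m) ≤ 12 * (r * r * m)
      ten≤twelve = begin
        5 * (2 * m)      ≡⟨ sym (*-assoc 5 2 m) ⟩
        10 * m           ≤⟨ *-monoˡ-≤ m (+-monoʳ-≤ 10 (z≤n {2})) ⟩
        12 * m           ≡⟨ cong (12 *_) (sym (*-identityˡ m)) ⟩
        12 * (1 * m)     ≤⟨ *-monoʳ-≤ 12 (*-monoˡ-≤ m (*-mono-≤ r≥1 r≥1)) ⟩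
        12 * (r * r * m) ∎

module _ {n r : ℕ} {G : Graph n} (χ : EdgeColoring G r) where
  open Packings G

  cover-bad-bowties : 3 ≤ n → ∀ m →
    (∀ Bs → length Bs ≤ 2 * m → Orderings.MinDegreeSum G (n + size (covered Bs))) →
    ((H : HamiltonCycle G) → ColorBiasLt χ H m) →
    ∃ λ (R : Subset n) → (∣ R ∣ ≤ r * (5 * (2 * m))) × NoBadBowtieOutside χ R
  cover-bad-bowties n≥3 m room unbiased = R , size-R , no-bad
    where
      saturated : ∀ k → ∃ λ Bs → (length Bs ≤ 2 * m) × ¬ ColourClass.BadOutside χ k (covered Bs)
      saturated k = ColourClass.saturatedPacking χ k n≥3 m room unbiased

      packing : Fin r → List (Bowtie n)
      packing k = proj₁ (saturated k)

      inR : Fin n → Bool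
      inR v = any (λ k → covered (packing k) v) (allFin r)

      R = Vec.tabulate inR

      size-R : ∣ R ∣ ≤ r * (5 * (2 * m))
      size-R = begin
        ∣ R ∣
          ≡⟨ ∣tabulate∣ inR ⟩
        size inR
          ≤⟨ sumMap-mono (λ v → ⟦any⟧≤ (λ k → covered (packing k) v) (allFin r)) (allFin n) ⟩
        sumFin (λ v → sumFin (λ k → ⟦ covered (packing k) v ⟧))
          ≡⟨ sumMap-swap (λ v k → ⟦ covered (packing k) v ⟧) (allFin n) (allFin r) ⟩
        sumFin (λ k → size (covered (packing k)))
          ≤⟨ sumMap-mono (λ k → ≤-trans (size-covered (packing k)) (*-monoʳ-≤ 5 (short k))) (allFin r) ⟩
        sumFin {r} (λ _ → 5 * (2 * m))
          ≡⟨ sumFin-const {r} (5 * (2 * m)) ⟩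
        r * (5 * (2 * m))
          ∎
        where
          open ≤-Reasoning
          short : ∀ k → length (packing k) ≤ 2 * m
          short k = proj₁ (proj₂ (saturated k))

      no-bad : NoBadBowtieOutside χ R
      no-bad v₁ v₂ v₃ v₄ v₅ v₁∉R v₂∉R v₃∉R v₄∉R v₅∉R isBowtie (k , bad) =
        proj₂ (proj₂ (saturated k))
          (v₁ , v₂ , v₃ , v₄ , v₅ ,
           (outside v₁∉R , outside v₂∉R , outside v₃∉R , outside v₄∉R , outside v₅∉R) , isBowtie , bad)
        where
          outside : ∀ {v} → v ∉ R → covered (packing k) v ≡ false
          outside {v} v∉R =
            any-false (λ k → covered (packing k) v) (allFin r) (∉tabulate inR v v∉R) (∈-allFin k)

-- N = 3 only because Hamilton cycles need three vertices.
proposition2p3 : (r m : ℕ) → 2 ≤ r → 1 ≤ m →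
    ∃ λ N → ∀ n → N ≤ n → (G : Graph n) (χ : EdgeColoring G r) →
    2 * minDegree G ≡ n + 12 * (r * r * m) →
    ((H : HamiltonCycle G) → ColorBiasLt χ H m) →
    ∃ λ (R : Subset n) → (∣ R ∣ ≤ 10 * r * m) × NoBadBowtieOutside χ R
proposition2p3 r m r≥2 _ = 3 , λ n n≥3 G χ minDegree≡ unbiased →
  let room = room-for-packings G r m (≤-trans (s≤s z≤n) r≥2) minDegree≡
      R , size-R , no-bad = cover-bad-bowties χ n≥3 m room unbiased
  in R , subst (∣ R ∣ ≤_) (reassociate r m) size-R , no-bad
  where
    reassociate : ∀ r m → r * (5 * (2 * m)) ≡ 10 * r * m
    reassociate = solve-∀
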